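{- In the folding setting described in the context, let $v\in W_A$ and $i\in I$ with $v\prec s_iv$ in the left weak order of $W_A$. Then the map $O'\mapsto\left(\prod_{j\in O'}s_j^B\right)f(v)$ is a poset isomorphism from the Boolean lattice of subsets $O'\subset O_i$ onto the interval $[f(v),f(s_iv)]$ of the left weak order $(W_B,\preceq)$.
   Context: Let $B=(b_{jk})_{j,k\in J}$ be a generalized Cartan matrix (GCM) and $\pi$ a permutation of $J$ with $b_{\pi(j)\pi(k)}=b_{jk}$, admissible: $b_{jk}=0$ whenever $j,k$ are in the same $\pi$-orbit. Let $I$ index the $\pi$-orbits, $O_i$ the orbit indexed by $i$, $o_i=|O_i|$, and $A$ the GCM with $a_{i'i}=\frac{o_{i'}}{o_i}\sum_{j\in O_i}b_{j'j}$ for any $j'\in O_{i'}$. $W_A$ (generators $s_i^A$) and $W_B$ (generators $s_j^B$) are the Weyl groups of $\mathfrak{g}(A),\mathfrak{g}(B)$. Left weak order: covers $u\prec s u$ for a simple reflection $s$ with $\ell(su)=\ell(u)+1$. $f:W_A\to W_B$ is the injective group homomorphism with $f(s_i^A)=\prod_{j\in O_i}s_j^B$ (factors commute by admissibility). -}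

module Defs where

open import Data.Nat using (ℕ; zero; suc; _≤_)
open import Data.Integer as ℤ using (ℤ; +_; _-_; _*_)
open import Data.Fin using (Fin; _≟_)
open import Data.Fin.Subset using (Subset; _∈_; _⊆_; ∣_∣)
open import Data.Fin.Subset.Properties using (_∈?_)
open import Data.Fin.Permutation using (Permutation′; _⟨$⟩ʳ_)
open import Data.List using (List; []; _∷_; length; filter; allFin; concatMap; foldr; map)
open import Data.Vec using (tabulate)
open import Data.Bool using (if_then_else_)
open import Data.Product using (Σ; _×_; ∃; _,_)
open import Function using (_∘_)
open import Function.Definitions using (Surjective)
open import Function.Bundles using (_⇔_)
open import Relation.Nullary using (¬_; does)
open import Relation.Binary.PropositionalEquality using (_≡_; _≢_)

Matrix : ℕ → Set
Matrix k = Fin k → Fin k → ℤ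

∑ : ∀ {k} → (Fin k → ℤ) → ℤ
∑ {k} g = foldr ℤ._+_ (+ 0) (map g (allFin k))

∑[_] : ∀ {k} → List (Fin k) → (Fin k → ℤ) → ℤ
∑[ js ] g = foldr ℤ._+_ (+ 0) (map g js)

record IsGCM {k : ℕ} (M : Matrix k) : Set where
  field
    diag    : ∀ j → M j j ≡ + 2
    offdiag : ∀ j l → j ≢ l → M j l ℤ.≤ + 0
    zeroSym : ∀ j l → M j l ≡ + 0 → M l j ≡ + 0

-- The Weyl group W(M) of g(M), realised through its (faithful) action on
-- the root lattice Q = ⊕_j ℤ α_j, with coordinates c : Fin k → ℤ.
-- s_j(α_l) = α_l - M j l α_j, i.e.  s_j(c) = c - (∑_l M j l c_l) α_j.
-- An element of W(M) is represented by a word [j₁,…,j_r] meaning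
-- s_{j₁} ⋯ s_{j_r}; two words are equal in W(M) iff they act equally.

sref : ∀ {k} → Matrix k → Fin k → (Fin k → ℤ) → (Fin k → ℤ)
sref M j c m = if does (m ≟ j) then c m - ∑ (λ l → M j l * c l) else c m

Word : ℕ → Set
Word k = List (Fin k)

act : ∀ {k} → Matrix k → Word k → (Fin k → ℤ) → (Fin k → ℤ)
act M []      c = c
act M (j ∷ w) c = sref M j (act M w c)

_≈[_]_ : ∀ {k} → Word k → Matrix k → Word k → Set
u ≈[ M ] w = ∀ c m → act M u c m ≡ act M w c m

HasLength : ∀ {k} → Matrix k → Word k → ℕ → Set
HasLength M w n =
  (Σ (Word _) λ u → (u ≈[ M ] w) × (length u ≡ n)) ×
  (∀ u → u ≈[ M ] w → n ≤ length u)

Cover : ∀ {k} → Matrix k → Word k → Word k → Set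
Cover M u w = Σ (Fin _) λ j → (w ≈[ M ] (j ∷ u)) ×
  (Σ ℕ λ n → HasLength M u n × HasLength M w (suc n))

data WeakLe {k} (M : Matrix k) : Word k → Word k → Set where
  wrefl : ∀ {u w} → u ≈[ M ] w → WeakLe M u w
  wstep : ∀ {u x w} → Cover M u x → WeakLe M x w → WeakLe M u w

InInterval : ∀ {k} → Matrix k → Word k → Word k → Word k → Set
InInterval M x y w = WeakLe M x w × WeakLe M w y

iter : ∀ {n} → (Fin n → Fin n) → ℕ → Fin n → Fin n
iter g zero    j = j
iter g (suc t) j = g (iter g t j)

SameOrbit : ∀ {n} → Permutation′ n → Fin n → Fin n → Set
SameOrbit π j l = ∃ λ t → iter (π ⟨$⟩ʳ_) t j ≡ l

Orbit : ∀ {n m} → (Fin n → Fin m) → Fin m → Subset n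
Orbit orb i = tabulate (λ j → does (orb j ≟ i))

elems : ∀ {n} → Subset n → List (Fin n)
elems {n} S = filter (_∈? S) (allFin n)

record Folding (n m : ℕ) : Set where
  field
    B       : Matrix n
    B-GCM   : IsGCM B
    π       : Permutation′ n
    π-inv   : ∀ j l → B (π ⟨$⟩ʳ j) (π ⟨$⟩ʳ l) ≡ B j l
    admiss  : ∀ j l → SameOrbit π j l → j ≢ l → B j l ≡ + 0
    orb     : Fin n → Fin m
    orb-surj : Surjective _≡_ _≡_ orb
    orb-orbit : ∀ j l → (orb j ≡ orb l) ⇔ SameOrbit π j l
    -- the folded matrix A:  a_{i'i} = (o_{i'}/o_i) ∑_{j∈O_i} b_{j'j}
    -- (for any j' ∈ O_{i'}), written with the denominator cleared
    A       : Matrix m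
    A-def   : ∀ i' i j' → orb j' ≡ i' →
              + ∣ Orbit orb i ∣ * A i' i
                ≡ + ∣ Orbit orb i' ∣ * ∑[ elems (Orbit orb i) ] (λ j → B j' j)

  -- f : W_A → W_B on words, f(s_i^A) = ∏_{j ∈ O_i} s_j^B
  fword : Word m → Word n
  fword = concatMap (λ i → elems (Orbit orb i))

  φ : Word m → Subset n → Word n
  φ v O' = elems O' Data.List.++ fword v

{-# OPTIONS --safe #-}
module Submission where

-- The Tits lemma (ℓ(s_j u) ≥ ℓ(u)
-- implies u⁻¹α_j ≥ 0, proved as usual by splitting off a dihedral factor and checking rank two by
-- hand) shows that u ≺ s_j u exactly when u⁻¹α_j is a positive root, and that a root made negative
-- by u stays negative above u in the weak order.
-- The map ι(α_i) = μ_i ∑_{j∈O_i} α_j intertwines W_A with f(W_A), and π permutes the roots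
-- f(v)⁻¹α_j (j ∈ O_i); since v⁻¹α_i > 0, all of them are positive.  The s_j, j ∈ O_i, are commuting
-- orthogonal reflections, so adding them to f(v) one at a time climbs the weak order: the map
-- O′ ↦ (∏_{j∈O′} s_j) f(v) is monotone.  Conversely, every step of a chain from f(v) to f(s_i v) is
-- some s_j with j ∈ O_i not used before (anything else would create an inversion that f(s_i v)
-- lacks, or undo one), and comparing inversions shows that the map reflects the order.

open import Defs
open import Data.Nat as ℕ using (ℕ; zero; suc; z≤n; s≤s; _∸_; _≤_; _<_)
import Data.Nat.Properties as ℕP
open import Data.Integer as ℤ using (ℤ; +_; -_; _-_; _*_; _+_; +≤+; -1ℤ; -[1+_])
import Data.Integer.Properties as ℤP
open import Data.Integer.Tactic.RingSolver using (solve-∀)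
open import Data.Fin as Fin using (Fin; _≟_; toℕ)
import Data.Fin.Properties as Fin
open import Data.Fin.Permutation using (Permutation′; _⟨$⟩ʳ_; _⟨$⟩ˡ_; inverseˡ; inverseʳ)
open import Data.Fin.Subset using (Subset; _⊆_; ∣_∣; ⊥; ⁅_⁆; _∪_; _∩_; ∁) renaming (_∈_ to _∈ₛ_; _∉_ to _∉ₛ_)
import Data.Fin.Subset.Properties as Subset
open import Data.List using (List; []; _∷_; _++_; length; map; filter; allFin)
import Data.List.Properties as List
open import Data.List.Membership.Propositional using (_∈_; _∉_)
import Data.List.Membership.Propositional.Properties as ∈
open import Data.List.Relation.Unary.Any using (here; there; any?)
open import Data.List.Relation.Unary.All as All using (All; []; _∷_)
open import Data.List.Relation.Unary.All.Properties using (All¬⇒¬Any)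
open import Data.List.Relation.Unary.AllPairs using ([]; _∷_)
open import Data.List.Relation.Unary.Unique.Propositional using (Unique)
import Data.List.Relation.Unary.Unique.Propositional.Properties as Unique
open import Data.Vec.Functional using (removeAt)
import Data.Vec.Properties as Vec
open import Data.Bool using (true; false; if_then_else_)
open import Data.Product using (Σ; _×_; _,_; proj₁; proj₂)
open import Data.Sum using (_⊎_; inj₁; inj₂)
open import Function using (_∘_)
open import Function.Bundles using (_⇔_; mk⇔; Equivalence)
open import Relation.Nullary using (Dec; does; yes; no; ¬_; contradiction)
open import Relation.Nullary.Decidable using (True; toWitness; _×-dec_; map′; dec-true; dec-false)
open import Relation.Binary.Bundles using (Setoid)
open import Relation.Binary.Definitions using (tri<; tri≈; tri>)
import Relation.Binary.Reasoning.Setoid as SetoidReasoning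
open import Relation.Binary.PropositionalEquality
import Algebra.Properties.CommutativeMonoid.Sum as CommutativeMonoidSum

RootLattice : ℕ → Set
RootLattice k = Fin k → ℤ

module _ {k : ℕ} where

  0ᴸ : RootLattice k
  0ᴸ _ = + 0

  _⊕_ : RootLattice k → RootLattice k → RootLattice k
  (c ⊕ d) m = c m + d m

  _⊙_ : ℤ → RootLattice k → RootLattice k
  (a ⊙ c) m = a * c m

  infixl 6 _⊕_
  infixl 7 _⊙_

  α : Fin k → RootLattice k
  α j m = if does (m ≟ j) then + 1 else + 0

  NonNeg : RootLattice k → Set
  NonNeg c = ∀ m → + 0 ℤ.≤ c m

  NonPos : RootLattice k → Set
  NonPos c = ∀ m → c m ℤ.≤ + 0

  α-same : ∀ j → α j j ≡ + 1
  α-same j rewrite dec-true (j ≟ j) refl = refl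

  α-other : ∀ {j m} → m ≢ j → α j m ≡ + 0
  α-other {j} {m} m≢j rewrite dec-false (m ≟ j) m≢j = refl

  α-comm : ∀ j m → α j m ≡ α m j
  α-comm j m with m ≟ j | j ≟ m
  ... | yes _   | yes _   = refl
  ... | no _    | no _    = refl
  ... | yes m≡j | no j≢m  = contradiction (sym m≡j) j≢m
  ... | no m≢j  | yes j≡m = contradiction (sym j≡m) m≢j

  α-nonNeg : ∀ j → NonNeg (α j)
  α-nonNeg j m with does (m ≟ j)
  ... | true  = +≤+ z≤n
  ... | false = +≤+ z≤n

  α≢0 : ∀ j → ¬ (α j ≗ 0ᴸ)
  α≢0 j α≗0 with () ← trans (sym (α-same j)) (α≗0 j)

nonPos-sum-zero : ∀ {a b} → a ℤ.≤ + 0 → b ℤ.≤ + 0 → a + b ≡ + 0 → a ≡ + 0 × b ≡ + 0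
nonPos-sum-zero {+ zero}  {+ zero}  _        _        _  = refl , refl
nonPos-sum-zero {+ suc _}           (+≤+ ()) _        _
nonPos-sum-zero {+ zero}  {+ suc _} _        (+≤+ ()) _
nonPos-sum-zero {+ zero}  { -[1+ _ ]} _      _        ()
nonPos-sum-zero { -[1+ _ ]} {+ zero}    _    _        ()
nonPos-sum-zero { -[1+ _ ]} {+ suc _}   _    (+≤+ ()) _
nonPos-sum-zero { -[1+ _ ]} { -[1+ _ ]} _    _        ()

module _ {k : ℕ} where

  ∑[]-cong-∈ : ∀ (L : List (Fin k)) {g h : Fin k → ℤ} →
               (∀ {l} → l ∈ L → g l ≡ h l) → ∑[ L ] g ≡ ∑[ L ] h
  ∑[]-cong-∈ []      g≡h = refl
  ∑[]-cong-∈ (l ∷ L) g≡h = cong₂ _+_ (g≡h (here refl)) (∑[]-cong-∈ L (g≡h ∘ there))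

  ∑[]-cong : ∀ (L : List (Fin k)) {g h : Fin k → ℤ} → g ≗ h → ∑[ L ] g ≡ ∑[ L ] h
  ∑[]-cong L g≗h = ∑[]-cong-∈ L (λ {l} _ → g≗h l)

  ∑[]-zero : ∀ (L : List (Fin k)) → ∑[ L ] (λ _ → + 0) ≡ + 0
  ∑[]-zero []      = refl
  ∑[]-zero (l ∷ L) = trans (ℤP.+-identityˡ _) (∑[]-zero L)

  ∑[]-+ : ∀ (L : List (Fin k)) (g h : Fin k → ℤ) →
          ∑[ L ] (λ l → g l + h l) ≡ ∑[ L ] g + ∑[ L ] h
  ∑[]-+ []      g h = refl
  ∑[]-+ (l ∷ L) g h rewrite ∑[]-+ L g h = swap (g l) (h l) (∑[ L ] g) (∑[ L ] h)
    where
    swap : ∀ a b c d → (a + b) + (c + d) ≡ (a + c) + (b + d)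
    swap = solve-∀

  ∑[]-*ˡ : ∀ (L : List (Fin k)) (a : ℤ) (g : Fin k → ℤ) →
           ∑[ L ] (λ l → a * g l) ≡ a * ∑[ L ] g
  ∑[]-*ˡ []      a g = sym (ℤP.*-zeroʳ a)
  ∑[]-*ˡ (l ∷ L) a g rewrite ∑[]-*ˡ L a g = sym (ℤP.*-distribˡ-+ a (g l) (∑[ L ] g))

  ∑[]-nonPos : ∀ (L : List (Fin k)) (g : Fin k → ℤ) →
               (∀ {l} → l ∈ L → g l ℤ.≤ + 0) → ∑[ L ] g ℤ.≤ + 0
  ∑[]-nonPos []      g g≤0 = +≤+ z≤n
  ∑[]-nonPos (l ∷ L) g g≤0 = ℤP.+-mono-≤ (g≤0 (here refl)) (∑[]-nonPos L g (g≤0 ∘ there))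

  ∑[]-nonPos-zero : ∀ (L : List (Fin k)) (g : Fin k → ℤ) → (∀ {l} → l ∈ L → g l ℤ.≤ + 0) →
                    ∑[ L ] g ≡ + 0 → ∀ {l} → l ∈ L → g l ≡ + 0
  ∑[]-nonPos-zero (l ∷ L) g g≤0 ∑≡0 l∈ with nonPos-sum-zero (g≤0 (here refl)) (∑[]-nonPos L g (g≤0 ∘ there)) ∑≡0
  ∑[]-nonPos-zero (l ∷ L) g g≤0 ∑≡0 (here refl)  | gl≡0 , _   = gl≡0
  ∑[]-nonPos-zero (l ∷ L) g g≤0 ∑≡0 (there l∈L) | _    , ∑≡0′ = ∑[]-nonPos-zero L g (g≤0 ∘ there) ∑≡0′ l∈L

  ∑[]-single : ∀ {L : List (Fin k)} {j} (g : Fin k → ℤ) → Unique L → j ∈ L →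
               (∀ {l} → l ∈ L → l ≢ j → g l ≡ + 0) → ∑[ L ] g ≡ g j
  ∑[]-single {l ∷ L} g (l∉L ∷ unique) (here refl) others =
    trans (cong (_+_ (g l)) (trans (∑[]-cong-∈ L rest≡0) (∑[]-zero L))) (ℤP.+-identityʳ (g l))
    where
    rest≡0 : ∀ {l′} → l′ ∈ L → g l′ ≡ + 0
    rest≡0 l′∈L = others (there l′∈L) (λ l′≡l → All.lookup l∉L l′∈L (sym l′≡l))
  ∑[]-single {l ∷ L} {j} g (l∉L ∷ unique) (there j∈L) others =
    trans (cong₂ _+_ (others (here refl) l≢j) (∑[]-single g unique j∈L (others ∘ there))) (ℤP.+-identityˡ (g j))
    where
    l≢j : l ≢ j
    l≢j l≡j = All.lookup l∉L j∈L l≡j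

∑[]-swap : ∀ {k k′} (L : List (Fin k)) (L′ : List (Fin k′)) (g : Fin k → Fin k′ → ℤ) →
           ∑[ L ] (λ a → ∑[ L′ ] (g a)) ≡ ∑[ L′ ] (λ b → ∑[ L ] (λ a → g a b))
∑[]-swap []      L′ g = sym (∑[]-zero L′)
∑[]-swap (a ∷ L) L′ g = trans (cong (_+_ (∑[ L′ ] (g a))) (∑[]-swap L L′ g))
                              (sym (∑[]-+ L′ (g a) (λ b → ∑[ L ] (λ a → g a b))))

∑[]-filter : ∀ {k} {P : Fin k → Set} (P? : ∀ l → Dec (P l)) (L : List (Fin k)) (g : Fin k → ℤ) →
             ∑[ filter P? L ] g ≡ ∑[ L ] (λ l → (if does (P? l) then + 1 else + 0) * g l)
∑[]-filter P? []      g = refl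
∑[]-filter P? (l ∷ L) g with does (P? l)
... | true  = cong₂ _+_ (sym (ℤP.*-identityˡ (g l))) (∑[]-filter P? L g)
... | false = trans (∑[]-filter P? L g) (sym (ℤP.+-identityˡ _))

module ∑ℤ = CommutativeMonoidSum ℤP.+-0-commutativeMonoid

module _ {k : ℕ} where

  ∑-cong : ∀ {g h : Fin k → ℤ} → g ≗ h → ∑ g ≡ ∑ h
  ∑-cong = ∑[]-cong (allFin k)

  ∑-+ : ∀ (g h : Fin k → ℤ) → ∑ (λ l → g l + h l) ≡ ∑ g + ∑ h
  ∑-+ = ∑[]-+ (allFin k)

  ∑-*ˡ : ∀ (a : ℤ) (g : Fin k → ℤ) → ∑ (λ l → a * g l) ≡ a * ∑ g
  ∑-*ˡ = ∑[]-*ˡ (allFin k)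

∑-suc : ∀ {k} (g : Fin (suc k) → ℤ) → ∑ g ≡ g Fin.zero + ∑ (g ∘ Fin.suc)
∑-suc g = cong (λ xs → g Fin.zero + Data.List.foldr _+_ (+ 0) xs)
  (trans (List.map-tabulate Fin.suc g) (sym (List.map-tabulate (λ l → l) (g ∘ Fin.suc))))

∑≡sum : ∀ {k} (g : Fin k → ℤ) → ∑ g ≡ ∑ℤ.sum g
∑≡sum {zero}  g = refl
∑≡sum {suc k} g = trans (∑-suc g) (cong (_+_ (g Fin.zero)) (∑≡sum (g ∘ Fin.suc)))

∑-permute : ∀ {k} (g : Fin k → ℤ) (π : Permutation′ k) → ∑ g ≡ ∑ (λ l → g (π ⟨$⟩ʳ l))
∑-permute g π = trans (∑≡sum g) (trans (∑ℤ.sum-permute g π) (sym (∑≡sum (λ l → g (π ⟨$⟩ʳ l)))))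

∑-α : ∀ {k} (g : Fin k → ℤ) j → ∑ (λ l → g l * α j l) ≡ g j
∑-α {k} g j = begin
  ∑ (λ l → g l * α j l)   ≡⟨ ∑[]-single (λ l → g l * α j l) (Unique.allFin⁺ k) (∈.∈-allFin j) off-j ⟩
  g j * α j j             ≡⟨ cong (g j *_) (α-same j) ⟩
  g j * + 1               ≡⟨ ℤP.*-identityʳ (g j) ⟩
  g j                     ∎
  where
  open ≡-Reasoning
  off-j : ∀ {l} → l ∈ allFin k → l ≢ j → g l * α j l ≡ + 0
  off-j {l} _ l≢j = trans (cong (g l *_) (α-other l≢j)) (ℤP.*-zeroʳ (g l))

nonNeg-* : ∀ {a b} → + 0 ℤ.≤ a → + 0 ℤ.≤ b → + 0 ℤ.≤ a * b
nonNeg-* {+ m} {+ n} _ _ = subst (+ 0 ℤ.≤_) (ℤP.pos-* m n) (+≤+ z≤n)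

nonNeg-+ : ∀ {a b} → + 0 ℤ.≤ a → + 0 ℤ.≤ b → + 0 ℤ.≤ a + b
nonNeg-+ {+ m} {+ n} _ _ = +≤+ z≤n

nonNeg-combination : ∀ {k} {a b} {c d : RootLattice k} → + 0 ℤ.≤ a → + 0 ℤ.≤ b → NonNeg c → NonNeg d →
                     NonNeg (a ⊙ c ⊕ b ⊙ d)
nonNeg-combination 0≤a 0≤b c≥0 d≥0 m = nonNeg-+ (nonNeg-* 0≤a (c≥0 m)) (nonNeg-* 0≤b (d≥0 m))

nonPos-*-nonNeg : ∀ {a b} → a ℤ.≤ + 0 → + 0 ℤ.≤ b → a * b ℤ.≤ + 0
nonPos-*-nonNeg {a} {b} a≤0 0≤b =
  subst (a * b ℤ.≤_) (ℤP.*-zeroˡ b) (ℤP.*-monoʳ-≤-nonNeg b {{ℤ.nonNegative 0≤b}} a≤0)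

module _ {k : ℕ} {c : RootLattice k} where

  -1⊙-nonNeg⇒nonPos : NonNeg (-1ℤ ⊙ c) → NonPos c
  -1⊙-nonNeg⇒nonPos -c≥0 m = ℤP.neg-cancel-≤ (subst (+ 0 ℤ.≤_) (ℤP.-1*i≡-i (c m)) (-c≥0 m))

  nonNeg⇒-1⊙-nonPos : NonNeg c → NonPos (-1ℤ ⊙ c)
  nonNeg⇒-1⊙-nonPos c≥0 m = subst (ℤ._≤ + 0) (sym (ℤP.-1*i≡-i (c m))) (ℤP.neg-mono-≤ (c≥0 m))

module _ {k : ℕ} where

  record Linear (F : RootLattice k → RootLattice k) : Set where
    field
      F-cong      : ∀ {c d} → c ≗ d → F c ≗ F d
      additive    : ∀ c d → F (c ⊕ d) ≗ F c ⊕ F d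
      homogeneous : ∀ a c → F (a ⊙ c) ≗ a ⊙ F c

    preserves-0 : F 0ᴸ ≗ 0ᴸ
    preserves-0 m = begin
      F 0ᴸ m            ≡⟨ F-cong (λ _ → sym (ℤP.*-zeroˡ (+ 0))) m ⟩
      F (+ 0 ⊙ 0ᴸ) m    ≡⟨ homogeneous (+ 0) 0ᴸ m ⟩
      + 0 * F 0ᴸ m      ≡⟨ ℤP.*-zeroˡ (F 0ᴸ m) ⟩
      + 0               ∎
      where open ≡-Reasoning

    preserves-∑ : ∀ (L : List (Fin k)) (c : Fin k → RootLattice k) →
                  F (λ m → ∑[ L ] (λ l → c l m)) ≗ λ m → ∑[ L ] (λ l → F (c l) m)
    preserves-∑ []      c = preserves-0
    preserves-∑ (l ∷ L) c m =
      trans (additive (c l) (λ m → ∑[ L ] (λ l → c l m)) m)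
            (cong (_+_ (F (c l) m)) (preserves-∑ L c m))

    combination : ∀ a b c d → F (a ⊙ c ⊕ b ⊙ d) ≗ a ⊙ F c ⊕ b ⊙ F d
    combination a b c d m =
      trans (additive (a ⊙ c) (b ⊙ d) m) (cong₂ _+_ (homogeneous a c m) (homogeneous b d m))

    expand : ∀ c → F c ≗ λ m → ∑ (λ l → c l * F (α l) m)
    expand c m = begin
      F c m                                            ≡⟨ F-cong c≗∑ m ⟩
      F (λ m → ∑ (λ l → (c l ⊙ α l) m)) m              ≡⟨ preserves-∑ (allFin k) (λ l → c l ⊙ α l) m ⟩
      ∑ (λ l → F (c l ⊙ α l) m)                        ≡⟨ ∑-cong (λ l → homogeneous (c l) (α l) m) ⟩
      ∑ (λ l → c l * F (α l) m)                        ∎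
      where
      open ≡-Reasoning
      c≗∑ : c ≗ λ m → ∑ (λ l → (c l ⊙ α l) m)
      c≗∑ m = sym (trans (∑-cong (λ l → cong (c l *_) (α-comm l m))) (∑-α c m))

  id-linear : Linear (λ c → c)
  id-linear = record { F-cong = λ c≗d → c≗d ; additive = λ _ _ _ → refl ; homogeneous = λ _ _ _ → refl }

  ∘-linear : ∀ {F G} → Linear F → Linear G → Linear (F ∘ G)
  ∘-linear {F} {G} LF LG = record
    { F-cong      = λ c≗d → LF.F-cong (LG.F-cong c≗d)
    ; additive    = λ c d m → trans (LF.F-cong (LG.additive c d) m) (LF.additive (G c) (G d) m)
    ; homogeneous = λ a c m → trans (LF.F-cong (LG.homogeneous a c) m) (LF.homogeneous a (G c) m)
    }
    where
    module LF = Linear LF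
    module LG = Linear LG

-- The Weyl group of a generalized Cartan matrix

least : ∀ {P : ℕ → Set} → (∀ n → Dec (P n)) → ∀ {N} → P N →
        Σ ℕ λ n → P n × (∀ {m} → P m → n ℕ.≤ m)
least     P? {zero}  p0 = zero , p0 , λ _ → z≤n
least {P} P? {suc N} pN with P? zero | least (P? ∘ suc) pN
... | yes p0  | _                = zero , p0 , λ _ → z≤n
... | no  ¬p0 | n , pn , n-least = suc n , pn , λ {m} → above m
  where
  above : ∀ m → P m → suc n ℕ.≤ m
  above zero    p0 = contradiction p0 ¬p0
  above (suc m) pm = s≤s (n-least pm)

module WeylGroup {k : ℕ} (M : Matrix k) (M-GCM : IsGCM M) where

  open IsGCM M-GCM

  -- ⟨α_j^∨, c⟩, so that s_j c = c - ⟨α_j^∨, c⟩ α_j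
  coroot : Fin k → RootLattice k → ℤ
  coroot j c = ∑ (λ l → M j l * c l)

  coroot-cong : ∀ j {c d} → c ≗ d → coroot j c ≡ coroot j d
  coroot-cong j c≗d = ∑-cong (λ l → cong (M j l *_) (c≗d l))

  coroot-α : ∀ j l → coroot j (α l) ≡ M j l
  coroot-α j l = ∑-α (M j) l

  coroot-⊕ : ∀ j c d → coroot j (c ⊕ d) ≡ coroot j c + coroot j d
  coroot-⊕ j c d = trans (∑-cong (λ l → ℤP.*-distribˡ-+ (M j l) (c l) (d l)))
                         (∑-+ (λ l → M j l * c l) (λ l → M j l * d l))

  coroot-⊙ : ∀ j a c → coroot j (a ⊙ c) ≡ a * coroot j c
  coroot-⊙ j a c = trans (∑-cong (λ l → exchange (M j l) a (c l))) (∑-*ˡ a (λ l → M j l * c l))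
    where
    exchange : ∀ x y z → x * (y * z) ≡ y * (x * z)
    exchange = solve-∀

  sref-≡ : ∀ j c → sref M j c ≗ c ⊕ (- coroot j c) ⊙ α j
  sref-≡ j c m with m ≟ j
  ... | yes _ = cong (_+_ (c m)) (sym (ℤP.*-identityʳ _))
  ... | no _  = sym (trans (cong (_+_ (c m)) (ℤP.*-zeroʳ (- coroot j c))) (ℤP.+-identityʳ (c m)))

  sref-same : ∀ j c → sref M j c j ≡ c j - coroot j c
  sref-same j c rewrite dec-true (j ≟ j) refl = refl

  sref-other : ∀ j c {m} → m ≢ j → sref M j c m ≡ c m
  sref-other j c {m} m≢j rewrite dec-false (m ≟ j) m≢j = refl

  coroot-sref : ∀ i j c → coroot i (sref M j c) ≡ coroot i c - M i j * coroot j c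
  coroot-sref i j c = begin
    coroot i (sref M j c)                                ≡⟨ coroot-cong i (sref-≡ j c) ⟩
    coroot i (c ⊕ (- coroot j c) ⊙ α j)                  ≡⟨ coroot-⊕ i c ((- coroot j c) ⊙ α j) ⟩
    coroot i c + coroot i ((- coroot j c) ⊙ α j)         ≡⟨ cong (_+_ (coroot i c)) (coroot-⊙ i (- coroot j c) (α j)) ⟩
    coroot i c + (- coroot j c) * coroot i (α j)         ≡⟨ cong (λ z → coroot i c + (- coroot j c) * z) (coroot-α i j) ⟩
    coroot i c + (- coroot j c) * M i j                  ≡⟨ rearrange (coroot i c) (coroot j c) (M i j) ⟩
    coroot i c - M i j * coroot j c                      ∎
    where
    open ≡-Reasoning
    rearrange : ∀ x y z → x + (- y) * z ≡ x - z * y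
    rearrange = solve-∀

  sref-cong : ∀ j {c d} → c ≗ d → sref M j c ≗ sref M j d
  sref-cong j {c} {d} c≗d m = begin
    sref M j c m                           ≡⟨ sref-≡ j c m ⟩
    c m + (- coroot j c) * α j m           ≡⟨ cong₂ (λ x y → x + (- y) * α j m) (c≗d m) (coroot-cong j c≗d) ⟩
    d m + (- coroot j d) * α j m           ≡⟨ sref-≡ j d m ⟨
    sref M j d m                           ∎
    where open ≡-Reasoning

  sref-linear : ∀ j → Linear (sref M j)
  sref-linear j = record { F-cong = sref-cong j ; additive = additive ; homogeneous = homogeneous }
    where
    open ≡-Reasoning
    additive : ∀ c d → sref M j (c ⊕ d) ≗ sref M j c ⊕ sref M j d
    additive c d m = begin
      sref M j (c ⊕ d) m                                            ≡⟨ sref-≡ j (c ⊕ d) m ⟩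
      c m + d m + (- coroot j (c ⊕ d)) * α j m                      ≡⟨ cong (λ z → c m + d m + (- z) * α j m) (coroot-⊕ j c d) ⟩
      c m + d m + (- (coroot j c + coroot j d)) * α j m              ≡⟨ distribute (c m) (d m) (coroot j c) (coroot j d) (α j m) ⟩
      (c m + (- coroot j c) * α j m) + (d m + (- coroot j d) * α j m) ≡⟨ cong₂ _+_ (sref-≡ j c m) (sref-≡ j d m) ⟨
      sref M j c m + sref M j d m                                   ∎
      where
      distribute : ∀ c d x y a → c + d + (- (x + y)) * a ≡ (c + (- x) * a) + (d + (- y) * a)
      distribute = solve-∀
    homogeneous : ∀ b c → sref M j (b ⊙ c) ≗ b ⊙ sref M j c
    homogeneous b c m = begin
      sref M j (b ⊙ c) m                      ≡⟨ sref-≡ j (b ⊙ c) m ⟩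
      b * c m + (- coroot j (b ⊙ c)) * α j m  ≡⟨ cong (λ z → b * c m + (- z) * α j m) (coroot-⊙ j b c) ⟩
      b * c m + (- (b * coroot j c)) * α j m  ≡⟨ factor b (c m) (coroot j c) (α j m) ⟩
      b * (c m + (- coroot j c) * α j m)      ≡⟨ cong (b *_) (sref-≡ j c m) ⟨
      b * sref M j c m                        ∎
      where
      factor : ∀ b c x a → b * c + (- (b * x)) * a ≡ b * (c + (- x) * a)
      factor = solve-∀

  coroot-sref-same : ∀ j c → coroot j (sref M j c) ≡ - coroot j c
  coroot-sref-same j c = begin
    coroot j (sref M j c)                ≡⟨ coroot-sref j j c ⟩
    coroot j c - M j j * coroot j c      ≡⟨ cong (λ z → coroot j c - z * coroot j c) (diag j) ⟩
    coroot j c - + 2 * coroot j c        ≡⟨ simplify (coroot j c) ⟩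
    - coroot j c                         ∎
    where
    open ≡-Reasoning
    simplify : ∀ x → x - + 2 * x ≡ - x
    simplify = solve-∀

  coroot-sref-orthogonal : ∀ i j c → M i j ≡ + 0 → coroot i (sref M j c) ≡ coroot i c
  coroot-sref-orthogonal i j c Mij≡0 = begin
    coroot i (sref M j c)                ≡⟨ coroot-sref i j c ⟩
    coroot i c - M i j * coroot j c      ≡⟨ cong (λ z → coroot i c - z * coroot j c) Mij≡0 ⟩
    coroot i c - + 0 * coroot j c        ≡⟨ simplify (coroot i c) (coroot j c) ⟩
    coroot i c                           ∎
    where
    open ≡-Reasoning
    simplify : ∀ x y → x - + 0 * y ≡ x
    simplify = solve-∀

  sref-involutive : ∀ j c → sref M j (sref M j c) ≗ c
  sref-involutive j c m = begin
    sref M j (sref M j c) m                                  ≡⟨ sref-≡ j (sref M j c) m ⟩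
    sref M j c m + (- coroot j (sref M j c)) * α j m         ≡⟨ cong₂ (λ x y → x + (- y) * α j m) (sref-≡ j c m) (coroot-sref-same j c) ⟩
    c m + (- coroot j c) * α j m + (- - coroot j c) * α j m  ≡⟨ cancel (c m) (coroot j c) (α j m) ⟩
    c m                                                      ∎
    where
    open ≡-Reasoning
    cancel : ∀ c x a → c + (- x) * a + (- - x) * a ≡ c
    cancel = solve-∀

  sref-α : ∀ j → sref M j (α j) ≗ -1ℤ ⊙ α j
  sref-α j m = begin
    sref M j (α j) m                          ≡⟨ sref-≡ j (α j) m ⟩
    α j m + (- coroot j (α j)) * α j m        ≡⟨ cong (λ z → α j m + (- z) * α j m) (trans (coroot-α j j) (diag j)) ⟩
    α j m + (- + 2) * α j m                   ≡⟨ negate (α j m) ⟩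
    -1ℤ * α j m                          ∎
    where
    open ≡-Reasoning
    negate : ∀ a → a + (- + 2) * a ≡ -1ℤ * a
    negate = solve-∀

  act-linear : ∀ u → Linear (act M u)
  act-linear []      = id-linear
  act-linear (j ∷ u) = ∘-linear (sref-linear j) (act-linear u)

  act-cong : ∀ u {c d} → c ≗ d → act M u c ≗ act M u d
  act-cong u = Linear.F-cong (act-linear u)

  act⁻¹ : Word k → RootLattice k → RootLattice k
  act⁻¹ []      c = c
  act⁻¹ (j ∷ u) c = act⁻¹ u (sref M j c)

  act⁻¹-linear : ∀ u → Linear (act⁻¹ u)
  act⁻¹-linear []      = id-linear
  act⁻¹-linear (j ∷ u) = ∘-linear (act⁻¹-linear u) (sref-linear j)

  act⁻¹-cong : ∀ u {c d} → c ≗ d → act⁻¹ u c ≗ act⁻¹ u d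
  act⁻¹-cong u = Linear.F-cong (act⁻¹-linear u)

  act-++ : ∀ u w c → act M (u ++ w) c ≡ act M u (act M w c)
  act-++ []      w c = refl
  act-++ (j ∷ u) w c = cong (sref M j) (act-++ u w c)

  act⁻¹-++ : ∀ u w c → act⁻¹ (u ++ w) c ≡ act⁻¹ w (act⁻¹ u c)
  act⁻¹-++ []      w c = refl
  act⁻¹-++ (j ∷ u) w c = act⁻¹-++ u w (sref M j c)

  act-act⁻¹ : ∀ u c → act M u (act⁻¹ u c) ≗ c
  act-act⁻¹ []      c m = refl
  act-act⁻¹ (j ∷ u) c m = trans (sref-cong j (act-act⁻¹ u (sref M j c)) m) (sref-involutive j c m)

  act⁻¹-act : ∀ u c → act⁻¹ u (act M u c) ≗ c
  act⁻¹-act []      c m = refl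
  act⁻¹-act (j ∷ u) c m = trans (act⁻¹-cong u (sref-involutive j (act M u c)) m) (act⁻¹-act u c m)

  _≈_ : Word k → Word k → Set
  u ≈ w = u ≈[ M ] w

  infix 4 _≈_

  ≈-refl : ∀ u → u ≈ u
  ≈-refl u c m = refl

  ≈-sym : ∀ u w → u ≈ w → w ≈ u
  ≈-sym u w u≈w c m = sym (u≈w c m)

  ≈-trans : ∀ u v w → u ≈ v → v ≈ w → u ≈ w
  ≈-trans u v w u≈v v≈w c m = trans (u≈v c m) (v≈w c m)

  ≈-setoid : Setoid _ _
  ≈-setoid = record
    { Carrier       = Word k
    ; _≈_           = _≈_
    ; isEquivalence = record { refl = λ {u} → ≈-refl u ; sym = λ {u} {w} → ≈-sym u w ; trans = λ {u} {v} {w} → ≈-trans u v w }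
    }

  module ≈-Reasoning = SetoidReasoning ≈-setoid

  ≈-∷ : ∀ j u w → u ≈ w → j ∷ u ≈ j ∷ w
  ≈-∷ j u w u≈w c = sref-cong j (u≈w c)

  ≈-++ˡ : ∀ x u w → u ≈ w → x ++ u ≈ x ++ w
  ≈-++ˡ x u w u≈w c m rewrite act-++ x u c | act-++ x w c = act-cong x (u≈w c) m

  ≈-++ʳ : ∀ x u w → u ≈ w → u ++ x ≈ w ++ x
  ≈-++ʳ x u w u≈w c m rewrite act-++ u x c | act-++ w x c = u≈w (act M x c) m

  ∷∷-cancel : ∀ j u → j ∷ j ∷ u ≈ u
  ∷∷-cancel j u c = sref-involutive j (act M u c)

  ≈⇒act⁻¹ : ∀ u w → u ≈ w → ∀ c → act⁻¹ u c ≗ act⁻¹ w c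
  ≈⇒act⁻¹ u w u≈w c m = begin
    act⁻¹ u c m                          ≡⟨ act⁻¹-cong u (λ m → sym (act-act⁻¹ w c m)) m ⟩
    act⁻¹ u (act M w (act⁻¹ w c)) m      ≡⟨ act⁻¹-cong u (λ m → sym (u≈w (act⁻¹ w c) m)) m ⟩
    act⁻¹ u (act M u (act⁻¹ w c)) m      ≡⟨ act⁻¹-act u (act⁻¹ w c) m ⟩
    act⁻¹ w c m                          ∎
    where open ≡-Reasoning

  ≈-from-basis : ∀ u w → (∀ l → act M u (α l) ≗ act M w (α l)) → u ≈ w
  ≈-from-basis u w agree c m = begin
    act M u c m                           ≡⟨ Linear.expand (act-linear u) c m ⟩
    ∑ (λ l → c l * act M u (α l) m)       ≡⟨ ∑-cong (λ l → cong (c l *_) (agree l m)) ⟩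
    ∑ (λ l → c l * act M w (α l) m)       ≡⟨ Linear.expand (act-linear w) c m ⟨
    act M w c m                           ∎
    where open ≡-Reasoning

  _≈?_ : ∀ u w → Dec (u ≈ w)
  u ≈? w = map′ (≈-from-basis u w) (λ u≈w l → u≈w (α l))
                (Fin.all? (λ l → Fin.all? (λ m → act M u (α l) m ℤ.≟ act M w (α l) m)))

  word-of-length? : ∀ n {P : Word k → Set} → (∀ u → Dec (P u)) →
                    Dec (Σ (Word k) λ u → length u ≡ n × P u)
  word-of-length? zero    P? with P? []
  ... | yes p  = yes ([] , refl , p)
  ... | no ¬p  = no λ where
    ([] , _ , p)     → ¬p p
    (_ ∷ _ , () , _)
  word-of-length? (suc n) P? with Fin.any? (λ j → word-of-length? n (λ u → P? (j ∷ u)))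
  ... | yes (j , u , refl , p) = yes (j ∷ u , refl , p)
  ... | no ¬p = no λ where
    ([] , () , _)
    (j ∷ u , refl , p) → ¬p (j , u , refl , p)

  private
    RepresentedWithLength : Word k → ℕ → Set
    RepresentedWithLength w n = Σ (Word k) λ u → length u ≡ n × u ≈ w

    shortest : ∀ w → Σ ℕ λ n → RepresentedWithLength w n × (∀ {m} → RepresentedWithLength w m → n ℕ.≤ m)
    shortest w = least (λ n → word-of-length? n (_≈? w)) (w , refl , ≈-refl w)

  -- opaque: only this specification is ever used, and unfolding the search would swamp type checking
  opaque
    len : Word k → ℕ
    len w = proj₁ (shortest w)

    len-witness : ∀ w → Σ (Word k) λ u → length u ≡ len w × u ≈ w
    len-witness w = proj₁ (proj₂ (shortest w))

    len-minimal : ∀ u w → u ≈ w → len w ℕ.≤ length u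
    len-minimal u w u≈w = proj₂ (proj₂ (shortest w)) (u , refl , u≈w)

  len-≈ : ∀ u w → u ≈ w → len u ≡ len w
  len-≈ u w u≈w with len-witness u | len-witness w
  ... | u′ , |u′| , u′≈u | w′ , |w′| , w′≈w =
    ℕP.≤-antisym (subst (len u ℕ.≤_) |w′| (len-minimal w′ u (≈-trans w′ w u w′≈w (≈-sym u w u≈w))))
                 (subst (len w ℕ.≤_) |u′| (len-minimal u′ w (≈-trans u′ u w u′≈u u≈w)))

  hasLength-len : ∀ w → HasLength M w (len w)
  hasLength-len w with len-witness w
  ... | u , |u| , u≈w = (u , u≈w , |u|) , λ u′ u′≈w → len-minimal u′ w u′≈w

  hasLength⇒len : ∀ {w n} → HasLength M w n → n ≡ len w
  hasLength⇒len {w} ((u , u≈w , |u|) , n-minimal) with len-witness w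
  ... | u′ , |u′| , u′≈w =
    ℕP.≤-antisym (subst (_ ℕ.≤_) |u′| (n-minimal u′ u′≈w)) (subst (len w ℕ.≤_) |u| (len-minimal u w u≈w))

  len-++ : ∀ u w → len (u ++ w) ℕ.≤ len u ℕ.+ len w
  len-++ u w with len-witness u | len-witness w
  ... | u′ , |u′| , u′≈u | w′ , |w′| , w′≈w =
    subst (len (u ++ w) ℕ.≤_) (trans (List.length-++ u′) (cong₂ ℕ._+_ |u′| |w′|)) (len-minimal (u′ ++ w′) (u ++ w) u′w′≈uw)
    where
    u′w′≈uw : u′ ++ w′ ≈ u ++ w
    u′w′≈uw = ≈-trans (u′ ++ w′) (u ++ w′) (u ++ w) (≈-++ʳ w′ u′ u u′≈u) (≈-++ˡ u w′ w w′≈w)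

  len-∷ : ∀ j w → len (j ∷ w) ℕ.≤ suc (len w)
  len-∷ j w = ℕP.≤-trans (len-++ (j ∷ []) w) (ℕP.+-monoˡ-≤ (len w) (len-minimal (j ∷ []) (j ∷ []) (≈-refl (j ∷ []))))

-- Rank two

data Letter : Set where
  S T : Letter

other : Letter → Letter
other S = T
other T = S

alternating : Letter → ℕ → List Letter
alternating x zero    = []
alternating x (suc n) = x ∷ alternating (other x) n

length-alternating : ∀ x n → length (alternating x n) ≡ n
length-alternating x zero    = refl
length-alternating x (suc n) = cong suc (length-alternating (other x) n)

otherⁿ : ℕ → Letter → Letter
otherⁿ zero    x = x
otherⁿ (suc n) x = otherⁿ n (other x)

alternating-+ : ∀ x m n → alternating x (m ℕ.+ n) ≡ alternating x m ++ alternating (otherⁿ m x) n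
alternating-+ x zero    n = refl
alternating-+ x (suc m) n = cong (x ∷_) (alternating-+ (other x) m n)

-- (c_s, c_t, ⟨α_s^∨, c⟩, ⟨α_t^∨, c⟩): all of c ∈ Q that the reflections s and t read or change
record Rank2 : Set where
  constructor ⟨_,_,_,_⟩
  field
    cₛ cₜ hₛ hₜ : ℤ

open Rank2 public

NonNeg₂ : Rank2 → Set
NonNeg₂ σ = + 0 ℤ.≤ cₛ σ × + 0 ℤ.≤ cₜ σ

nonNeg₂? : ∀ σ → Dec (NonNeg₂ σ)
nonNeg₂? σ = (+ 0 ℤ.≤? cₛ σ) ×-dec (+ 0 ℤ.≤? cₜ σ)

⟨⟩-cong : ∀ {x x′ y y′ f f′ g g′} → x ≡ x′ → y ≡ y′ → f ≡ f′ → g ≡ g′ →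
          ⟨ x , y , f , g ⟩ ≡ ⟨ x′ , y′ , f′ , g′ ⟩
⟨⟩-cong refl refl refl refl = refl

_⊞_ : Rank2 → Rank2 → Rank2
⟨ x , y , f , g ⟩ ⊞ ⟨ x′ , y′ , f′ , g′ ⟩ = ⟨ x + x′ , y + y′ , f + f′ , g + g′ ⟩

_⊡_ : ℤ → Rank2 → Rank2
z ⊡ ⟨ x , y , f , g ⟩ = ⟨ z * x , z * y , z * f , z * g ⟩

infixl 6 _⊞_
infixl 7 _⊡_

e₁ e₂ e₃ e₄ : Rank2
e₁ = ⟨ + 1 , + 0 , + 0 , + 0 ⟩
e₂ = ⟨ + 0 , + 1 , + 0 , + 0 ⟩
e₃ = ⟨ + 0 , + 0 , + 1 , + 0 ⟩
e₄ = ⟨ + 0 , + 0 , + 0 , + 1 ⟩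

basis-expansion : ∀ x y f g → ⟨ x , y , f , g ⟩ ≡ x ⊡ e₁ ⊞ y ⊡ e₂ ⊞ f ⊡ e₃ ⊞ g ⊡ e₄
basis-expansion x y f g = ⟨⟩-cong (first x y f g) (second x y f g) (third x y f g) (fourth x y f g)
  where
  first : ∀ x y f g → x ≡ x * + 1 + y * + 0 + f * + 0 + g * + 0
  first = solve-∀
  second : ∀ x y f g → y ≡ x * + 0 + y * + 1 + f * + 0 + g * + 0
  second = solve-∀
  third : ∀ x y f g → f ≡ x * + 0 + y * + 0 + f * + 1 + g * + 0
  third = solve-∀
  fourth : ∀ x y f g → g ≡ x * + 0 + y * + 0 + f * + 0 + g * + 1
  fourth = solve-∀

-- Every coordinate update of a simple reflection has the shape u - w * v.
-∗-⊞ : ∀ w u u′ v v′ → (u + u′) - w * (v + v′) ≡ (u - w * v) + (u′ - w * v′)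
-∗-⊞ = solve-∀

-∗-⊡ : ∀ w z u v → z * u - w * (z * v) ≡ z * (u - w * v)
-∗-⊡ = solve-∀

module Rank2Action (a b : ℤ) where

  step : Letter → Rank2 → Rank2
  step S ⟨ x , y , f , g ⟩ = ⟨ x - + 1 * f , y , f - + 2 * f , g - b * f ⟩
  step T ⟨ x , y , f , g ⟩ = ⟨ x , y - + 1 * g , f - a * g , g - + 2 * g ⟩

  run : List Letter → Rank2 → Rank2
  run []      σ = σ
  run (x ∷ y) σ = step x (run y σ)

  run⁻¹ : List Letter → Rank2 → Rank2
  run⁻¹ []      σ = σ
  run⁻¹ (x ∷ y) σ = run⁻¹ y (step x σ)

  step-⊞ : ∀ x σ τ → step x (σ ⊞ τ) ≡ step x σ ⊞ step x τ
  step-⊞ S ⟨ x , y , f , g ⟩ ⟨ x′ , y′ , f′ , g′ ⟩ =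
    ⟨⟩-cong (-∗-⊞ (+ 1) x x′ f f′) refl (-∗-⊞ (+ 2) f f′ f f′) (-∗-⊞ b g g′ f f′)
  step-⊞ T ⟨ x , y , f , g ⟩ ⟨ x′ , y′ , f′ , g′ ⟩ =
    ⟨⟩-cong refl (-∗-⊞ (+ 1) y y′ g g′) (-∗-⊞ a f f′ g g′) (-∗-⊞ (+ 2) g g′ g g′)

  step-⊡ : ∀ x z σ → step x (z ⊡ σ) ≡ z ⊡ step x σ
  step-⊡ S z ⟨ x , y , f , g ⟩ = ⟨⟩-cong (-∗-⊡ (+ 1) z x f) refl (-∗-⊡ (+ 2) z f f) (-∗-⊡ b z g f)
  step-⊡ T z ⟨ x , y , f , g ⟩ = ⟨⟩-cong refl (-∗-⊡ (+ 1) z y g) (-∗-⊡ a z f g) (-∗-⊡ (+ 2) z g g)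

  run-⊞ : ∀ y σ τ → run y (σ ⊞ τ) ≡ run y σ ⊞ run y τ
  run-⊞ []      σ τ = refl
  run-⊞ (x ∷ y) σ τ = trans (cong (step x) (run-⊞ y σ τ)) (step-⊞ x (run y σ) (run y τ))

  run-⊡ : ∀ y z σ → run y (z ⊡ σ) ≡ z ⊡ run y σ
  run-⊡ []      z σ = refl
  run-⊡ (x ∷ y) z σ = trans (cong (step x) (run-⊡ y z σ)) (step-⊡ x z (run y σ))

  run-expand : ∀ y σ → run y σ ≡ cₛ σ ⊡ run y e₁ ⊞ cₜ σ ⊡ run y e₂ ⊞ hₛ σ ⊡ run y e₃ ⊞ hₜ σ ⊡ run y e₄
  run-expand y σ@(⟨ x , x′ , f , g ⟩)
    rewrite basis-expansion x x′ f g
          | run-⊞ y (x ⊡ e₁ ⊞ x′ ⊡ e₂ ⊞ f ⊡ e₃) (g ⊡ e₄) | run-⊞ y (x ⊡ e₁ ⊞ x′ ⊡ e₂) (f ⊡ e₃)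
          | run-⊞ y (x ⊡ e₁) (x′ ⊡ e₂)
          | run-⊡ y x e₁ | run-⊡ y x′ e₂ | run-⊡ y f e₃ | run-⊡ y g e₄ = refl

  run-from-basis : ∀ y y′ → run y e₁ ≡ run y′ e₁ → run y e₂ ≡ run y′ e₂ →
                   run y e₃ ≡ run y′ e₃ → run y e₄ ≡ run y′ e₄ → ∀ σ → run y σ ≡ run y′ σ
  run-from-basis y y′ h₁ h₂ h₃ h₄ σ rewrite run-expand y σ | run-expand y′ σ | h₁ | h₂ | h₃ | h₄ = refl

  initial : Rank2
  initial = ⟨ + 1 , + 0 , + 2 , b ⟩

  _≟₂_ : (σ τ : Rank2) → Dec (σ ≡ τ)
  ⟨ x , y , f , g ⟩ ≟₂ ⟨ x′ , y′ , f′ , g′ ⟩ =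
    map′ (λ (x≡ , y≡ , f≡ , g≡) → ⟨⟩-cong x≡ y≡ f≡ g≡) (λ { refl → refl , refl , refl , refl })
         (x ℤ.≟ x′ ×-dec y ℤ.≟ y′ ×-dec f ℤ.≟ f′ ×-dec g ℤ.≟ g′)

  record FiniteType (m : ℕ) : Set where
    field
      -- (st)^m = 1, in the form  x y x … (m + 1 letters) = y x y … (m - 1 letters)
      braid    : ∀ x σ → run (alternating x (suc m)) σ ≡ run (alternating (other x) (m ∸ 1)) σ
      positive : ∀ j → j ℕ.< m → NonNeg₂ (run⁻¹ (alternating T j) initial)

  private
    AgreeOnBasis : List Letter → List Letter → Set
    AgreeOnBasis y y′ = run y e₁ ≡ run y′ e₁ × run y e₂ ≡ run y′ e₂ × run y e₃ ≡ run y′ e₃ × run y e₄ ≡ run y′ e₄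

    agree-on-basis? : ∀ y y′ → Dec (AgreeOnBasis y y′)
    agree-on-basis? y y′ = (run y e₁ ≟₂ run y′ e₁) ×-dec (run y e₂ ≟₂ run y′ e₂) ×-dec
                           (run y e₃ ≟₂ run y′ e₃) ×-dec (run y e₄ ≟₂ run y′ e₄)

    braid? : ∀ m x → Dec (AgreeOnBasis (alternating x (suc m)) (alternating (other x) (m ∸ 1)))
    braid? m x = agree-on-basis? (alternating x (suc m)) (alternating (other x) (m ∸ 1))

    positive? : ∀ m → Dec (∀ (j : Fin m) → NonNeg₂ (run⁻¹ (alternating T (toℕ j)) initial))
    positive? m = Fin.all? (λ j → nonNeg₂? (run⁻¹ (alternating T (toℕ j)) initial))

  finite-type : ∀ m → True (braid? m S) → True (braid? m T) → True (positive? m) → FiniteType m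
  finite-type m braidS braidT pos = record { braid = braid ; positive = positive }
    where
    braid : ∀ x σ → run (alternating x (suc m)) σ ≡ run (alternating (other x) (m ∸ 1)) σ
    braid S with h₁ , h₂ , h₃ , h₄ ← toWitness braidS = run-from-basis (alternating S (suc m)) (alternating T (m ∸ 1)) h₁ h₂ h₃ h₄
    braid T with h₁ , h₂ , h₃ , h₄ ← toWitness braidT = run-from-basis (alternating T (suc m)) (alternating S (m ∸ 1)) h₁ h₂ h₃ h₄
    positive : ∀ j → j ℕ.< m → NonNeg₂ (run⁻¹ (alternating T j) initial)
    positive j j<m = subst (λ j → NonNeg₂ (run⁻¹ (alternating T j) initial))
                           (Fin.toℕ-fromℕ< j<m) (toWitness pos (Fin.fromℕ< j<m))

rank2-classification : ∀ p q → (p ≡ 0 → q ≡ 0) → (q ≡ 0 → p ≡ 0) →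
                       (Σ ℕ λ m → Rank2Action.FiniteType (- + p) (- + q) m) ⊎ 4 ℕ.≤ p ℕ.* q
rank2-classification 0       0       _ _ = inj₁ (2 , Rank2Action.finite-type _ _ 2 _ _ _)
rank2-classification 0       (suc q) p≡0⇒q≡0 _ with () ← p≡0⇒q≡0 refl
rank2-classification (suc p) 0       _ q≡0⇒p≡0 with () ← q≡0⇒p≡0 refl
rank2-classification 1 1 _ _ = inj₁ (3 , Rank2Action.finite-type _ _ 3 _ _ _)
rank2-classification 1 2 _ _ = inj₁ (4 , Rank2Action.finite-type _ _ 4 _ _ _)
rank2-classification 2 1 _ _ = inj₁ (4 , Rank2Action.finite-type _ _ 4 _ _ _)
rank2-classification 1 3 _ _ = inj₁ (6 , Rank2Action.finite-type _ _ 6 _ _ _)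
rank2-classification 3 1 _ _ = inj₁ (6 , Rank2Action.finite-type _ _ 6 _ _ _)
rank2-classification 1 (suc (suc (suc (suc q)))) _ _ = inj₂ (s≤s (s≤s (s≤s (s≤s z≤n))))
rank2-classification 2 (suc (suc q)) _ _ = inj₂ (ℕP.*-monoʳ-≤ 2 (s≤s (s≤s (z≤n {q}))))
rank2-classification 3 (suc (suc q)) _ _ = inj₂ (ℕP.≤-trans (ℕP.m≤m+n 4 2) (ℕP.*-monoʳ-≤ 3 (s≤s (s≤s (z≤n {q})))))
rank2-classification (suc (suc (suc (suc p)))) (suc q) _ _ = inj₂ (ℕP.*-mono-≤ (s≤s (s≤s (s≤s (s≤s (z≤n {p}))))) (s≤s (z≤n {q})))

-- The invariant that keeps every alternating word positive when pq ≥ 4.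
coefficients-grow : ∀ p q f g → 4 ℕ.≤ p ℕ.* q → 2 ℕ.* f ℕ.≤ p ℕ.* g → 2 ℕ.* g ℕ.≤ q ℕ.* (p ℕ.* g ∸ f)
coefficients-grow p q f g 4≤pq 2f≤pg = ℕP.*-cancelˡ-≤ 2 (begin
  2 ℕ.* (2 ℕ.* g)            ≡⟨ ℕP.*-assoc 2 2 g ⟨
  4 ℕ.* g                    ≤⟨ ℕP.*-monoˡ-≤ g 4≤pq ⟩
  p ℕ.* q ℕ.* g              ≡⟨ cong (ℕ._* g) (ℕP.*-comm p q) ⟩
  q ℕ.* p ℕ.* g              ≡⟨ ℕP.*-assoc q p g ⟩
  q ℕ.* P                    ≤⟨ ℕP.*-monoʳ-≤ q P≤2[P∸f] ⟩
  q ℕ.* (2 ℕ.* (P ∸ f))      ≡⟨ ℕP.*-comm q (2 ℕ.* (P ∸ f)) ⟩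
  2 ℕ.* (P ∸ f) ℕ.* q        ≡⟨ ℕP.*-assoc 2 (P ∸ f) q ⟩
  2 ℕ.* ((P ∸ f) ℕ.* q)      ≡⟨ cong (2 ℕ.*_) (ℕP.*-comm (P ∸ f) q) ⟩
  2 ℕ.* (q ℕ.* (P ∸ f))      ∎)
  where
  open ℕP.≤-Reasoning
  P = p ℕ.* g
  P≤2[P∸f] : P ℕ.≤ 2 ℕ.* (P ∸ f)
  P≤2[P∸f] = begin
    P                        ≡⟨ ℕP.m+n∸n≡m P P ⟨
    P ℕ.+ P ∸ P              ≤⟨ ℕP.∸-monoʳ-≤ (P ℕ.+ P) 2f≤pg ⟩
    P ℕ.+ P ∸ 2 ℕ.* f        ≡⟨ cong (λ z → P ℕ.+ z ∸ 2 ℕ.* f) (ℕP.+-identityʳ P) ⟨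
    2 ℕ.* P ∸ 2 ℕ.* f        ≡⟨ ℕP.*-distribˡ-∸ 2 P f ⟨
    2 ℕ.* (P ∸ f)            ∎

private
  add-negated : ∀ x g → + x - + 1 * - + g ≡ + (x ℕ.+ g)
  add-negated x g = trans (simplify (+ x) (+ g)) (sym (ℤP.pos-+ x g))
    where
    simplify : ∀ x g → x - + 1 * - g ≡ x + g
    simplify = solve-∀

  reflect-negated : ∀ g → - + g - + 2 * - + g ≡ + g
  reflect-negated g = simplify (+ g)
    where
    simplify : ∀ g → - g - + 2 * - g ≡ g
    simplify = solve-∀

  subtract-product : ∀ f p g → f ℕ.≤ p ℕ.* g → + f - (- + p) * (- + g) ≡ - + (p ℕ.* g ∸ f)
  subtract-product f p g f≤pg = begin
    + f - (- + p) * (- + g)  ≡⟨ simplify (+ f) (+ p) (+ g) ⟩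
    + f - + p * + g          ≡⟨ cong (λ z → + f - z) (ℤP.pos-* p g) ⟨
    + f - + (p ℕ.* g)        ≡⟨ ℤP.m-n≡m⊖n f (p ℕ.* g) ⟩
    f ℤ.⊖ p ℕ.* g            ≡⟨ ℤP.⊖-≤ f≤pg ⟩
    - + (p ℕ.* g ∸ f)        ∎
    where
    open ≡-Reasoning
    simplify : ∀ f p g → f - (- p) * (- g) ≡ f - p * g
    simplify = solve-∀

module InfiniteType (p q : ℕ) (4≤pq : 4 ℕ.≤ p ℕ.* q) where

  open Rank2Action (- + p) (- + q)

  private
    4≤qp : 4 ℕ.≤ q ℕ.* p
    4≤qp = subst (4 ℕ.≤_) (ℕP.*-comm p q) 4≤pq

    positive-from-T : ∀ j x y f g → 2 ℕ.* f ℕ.≤ p ℕ.* g →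
                      NonNeg₂ (run⁻¹ (alternating T j) ⟨ + x , + y , + f , - + g ⟩)
    positive-from-S : ∀ j x y f g → 2 ℕ.* g ℕ.≤ q ℕ.* f →
                      NonNeg₂ (run⁻¹ (alternating S j) ⟨ + x , + y , - + f , + g ⟩)
    positive-from-T zero    x y f g _     = +≤+ z≤n , +≤+ z≤n
    positive-from-T (suc j) x y f g 2f≤pg
      rewrite add-negated y g | subtract-product f p g (ℕP.≤-trans (ℕP.m≤m+n f _) 2f≤pg) | reflect-negated g
      = positive-from-S j x (y ℕ.+ g) (p ℕ.* g ∸ f) g (coefficients-grow p q f g 4≤pq 2f≤pg)
    positive-from-S zero    x y f g _     = +≤+ z≤n , +≤+ z≤n
    positive-from-S (suc j) x y f g 2g≤qf
      rewrite add-negated x f | reflect-negated f | subtract-product g q f (ℕP.≤-trans (ℕP.m≤m+n g _) 2g≤qf)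
      = positive-from-T j (x ℕ.+ f) y f (q ℕ.* f ∸ g) (coefficients-grow q p g f 4≤qp 2g≤qf)

  positive : ∀ j → NonNeg₂ (run⁻¹ (alternating T j) initial)
  positive j = positive-from-T j 1 0 2 q 4≤pq

nonPos⇒≡-∣∣ : ∀ {z} → z ℤ.≤ + 0 → z ≡ - + ℤ.∣ z ∣
nonPos⇒≡-∣∣ {+ zero}   _ = refl
nonPos⇒≡-∣∣ {+ suc _}  (+≤+ ())
nonPos⇒≡-∣∣ { -[1+ _ ]} _ = refl

module Dihedral {k : ℕ} (M : Matrix k) (M-GCM : IsGCM M) {s t : Fin k} (s≢t : s ≢ t) where

  open WeylGroup M M-GCM
  open IsGCM M-GCM
  open Rank2Action (M s t) (M t s)

  letter : Letter → Fin k
  letter S = s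
  letter T = t

  word : List Letter → Word k
  word = map letter

  state : RootLattice k → Rank2
  state c = ⟨ c s , c t , coroot s c , coroot t c ⟩

  private
    t≢s : t ≢ s
    t≢s t≡s = s≢t (sym t≡s)

    minus-one-times : ∀ x y → x - y ≡ x - + 1 * y
    minus-one-times x y = cong (_-_ x) (sym (ℤP.*-identityˡ y))

  state-sref : ∀ x c → state (sref M (letter x) c) ≡ step x (state c)
  state-sref S c = ⟨⟩-cong (trans (sref-same s c) (minus-one-times (c s) (coroot s c))) (sref-other s c t≢s)
    (trans (coroot-sref s s c) (cong (λ z → coroot s c - z * coroot s c) (diag s))) (coroot-sref t s c)
  state-sref T c = ⟨⟩-cong (sref-other t c s≢t) (trans (sref-same t c) (minus-one-times (c t) (coroot t c)))
    (coroot-sref s t c) (trans (coroot-sref t t c) (cong (λ z → coroot t c - z * coroot t c) (diag t)))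

  state-act : ∀ y c → state (act M (word y) c) ≡ run y (state c)
  state-act []      c = refl
  state-act (x ∷ y) c = trans (state-sref x (act M (word y) c)) (cong (step x) (state-act y c))

  state-act⁻¹ : ∀ y c → state (act⁻¹ (word y) c) ≡ run⁻¹ y (state c)
  state-act⁻¹ []      c = refl
  state-act⁻¹ (x ∷ y) c = trans (state-act⁻¹ y (sref M (letter x) c)) (cong (run⁻¹ y) (state-sref x c))

  private
    letter-other : ∀ x {m} → m ≢ s → m ≢ t → m ≢ letter x
    letter-other S m≢s _ = m≢s
    letter-other T _ m≢t = m≢t

  act-outside : ∀ y c {m} → m ≢ s → m ≢ t → act M (word y) c m ≡ c m
  act-outside []      c m≢s m≢t = refl
  act-outside (x ∷ y) c m≢s m≢t =
    trans (sref-other (letter x) (act M (word y) c) (letter-other x m≢s m≢t)) (act-outside y c m≢s m≢t)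

  act⁻¹-outside : ∀ y c {m} → m ≢ s → m ≢ t → act⁻¹ (word y) c m ≡ c m
  act⁻¹-outside []      c m≢s m≢t = refl
  act⁻¹-outside (x ∷ y) c m≢s m≢t =
    trans (act⁻¹-outside y (sref M (letter x) c) m≢s m≢t) (sref-other (letter x) c (letter-other x m≢s m≢t))

  ≗-by-cases : ∀ {c d : RootLattice k} → c s ≡ d s → c t ≡ d t → (∀ {m} → m ≢ s → m ≢ t → c m ≡ d m) → c ≗ d
  ≗-by-cases at-s at-t outside m with m ≟ s | m ≟ t
  ... | yes refl | _        = at-s
  ... | no _     | yes refl = at-t
  ... | no m≢s   | no m≢t   = outside m≢s m≢t

  run≡⇒≈ : ∀ y y′ → (∀ σ → run y σ ≡ run y′ σ) → word y ≈ word y′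
  run≡⇒≈ y y′ run≡ c = ≗-by-cases (cong cₛ same-state) (cong cₜ same-state)
    (λ m≢s m≢t → trans (act-outside y c m≢s m≢t) (sym (act-outside y′ c m≢s m≢t)))
    where
    same-state : state (act M (word y) c) ≡ state (act M (word y′) c)
    same-state = trans (state-act y c) (trans (run≡ (state c)) (sym (state-act y′ c)))

  state-α : state (α s) ≡ initial
  state-α = ⟨⟩-cong (α-same s) (α-other t≢s) (trans (coroot-α s s) (diag s)) (coroot-α t s)

  act⁻¹-α : ∀ y → let σ = run⁻¹ y initial in act⁻¹ (word y) (α s) ≗ cₛ σ ⊙ α s ⊕ cₜ σ ⊙ α t
  act⁻¹-α y = ≗-by-cases at-s at-t outside
    where
    open ≡-Reasoning
    σ = run⁻¹ y initial
    state≡ : state (act⁻¹ (word y) (α s)) ≡ σ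
    state≡ = trans (state-act⁻¹ y (α s)) (cong (run⁻¹ y) state-α)
    first : ∀ a b → a ≡ a * + 1 + b * + 0
    first = solve-∀
    second : ∀ a b → b ≡ a * + 0 + b * + 1
    second = solve-∀
    neither : ∀ a b → + 0 ≡ a * + 0 + b * + 0
    neither = solve-∀
    at-s : act⁻¹ (word y) (α s) s ≡ cₛ σ * α s s + cₜ σ * α t s
    at-s = begin
      act⁻¹ (word y) (α s) s        ≡⟨ cong cₛ state≡ ⟩
      cₛ σ                          ≡⟨ first (cₛ σ) (cₜ σ) ⟩
      cₛ σ * + 1 + cₜ σ * + 0       ≡⟨ cong₂ (λ p q → cₛ σ * p + cₜ σ * q) (α-same s) (α-other s≢t) ⟨
      cₛ σ * α s s + cₜ σ * α t s   ∎
    at-t : act⁻¹ (word y) (α s) t ≡ cₛ σ * α s t + cₜ σ * α t t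
    at-t = begin
      act⁻¹ (word y) (α s) t        ≡⟨ cong cₜ state≡ ⟩
      cₜ σ                          ≡⟨ second (cₛ σ) (cₜ σ) ⟩
      cₛ σ * + 0 + cₜ σ * + 1       ≡⟨ cong₂ (λ p q → cₛ σ * p + cₜ σ * q) (α-other t≢s) (α-same t) ⟨
      cₛ σ * α s t + cₜ σ * α t t   ∎
    outside : ∀ {m} → m ≢ s → m ≢ t → act⁻¹ (word y) (α s) m ≡ cₛ σ * α s m + cₜ σ * α t m
    outside {m} m≢s m≢t = begin
      act⁻¹ (word y) (α s) m        ≡⟨ act⁻¹-outside y (α s) m≢s m≢t ⟩
      α s m                         ≡⟨ α-other m≢s ⟩
      + 0                           ≡⟨ neither (cₛ σ) (cₜ σ) ⟩
      cₛ σ * + 0 + cₜ σ * + 0       ≡⟨ cong₂ (λ p q → cₛ σ * p + cₜ σ * q) (α-other m≢s) (α-other m≢t) ⟨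
      cₛ σ * α s m + cₜ σ * α t m   ∎

  length-word : ∀ y → length (word y) ≡ length y
  length-word = List.length-map letter

  len-word≤ : ∀ y y′ → word y′ ≈ word y → len (word y) ≤ length y′
  len-word≤ y y′ y′≈y = subst (len (word y) ≤_) (length-word y′) (len-minimal (word y′) (word y) y′≈y)

  private
    len-repeated : ∀ x y → len (word (x ∷ x ∷ y)) ≤ length y
    len-repeated x y = len-word≤ (x ∷ x ∷ y) y (≈-sym (word (x ∷ x ∷ y)) (word y) (∷∷-cancel (letter x) (word y)))

    tail-reduced : ∀ x y → length (x ∷ y) ≤ len (word (x ∷ y)) → length y ≤ len (word y)
    tail-reduced x y red = ℕP.≤-pred (ℕP.≤-trans red (len-∷ (letter x) (word y)))

  alternating-if-reduced : ∀ x y → length (x ∷ y) ≤ len (word (x ∷ y)) → x ∷ y ≡ alternating x (length (x ∷ y))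
  alternating-if-reduced x []      _   = refl
  alternating-if-reduced S (S ∷ y) red = contradiction (ℕP.≤-trans (ℕP.n≤1+n _) (ℕP.≤-trans red (len-repeated S y))) (ℕP.n≮n _)
  alternating-if-reduced T (T ∷ y) red = contradiction (ℕP.≤-trans (ℕP.n≤1+n _) (ℕP.≤-trans red (len-repeated T y))) (ℕP.n≮n _)
  alternating-if-reduced S (T ∷ y) red = cong (S ∷_) (alternating-if-reduced T y (tail-reduced S (T ∷ y) red))
  alternating-if-reduced T (S ∷ y) red = cong (T ∷_) (alternating-if-reduced S y (tail-reduced T (S ∷ y) red))

  module _ {m : ℕ} (finite : FiniteType m) where

    open FiniteType finite

    private
      braid-≈ : ∀ x → word (alternating (other x) (m ∸ 1)) ≈ word (alternating x (suc m))
      braid-≈ x = run≡⇒≈ (alternating (other x) (m ∸ 1)) (alternating x (suc m)) (λ σ → sym (braid x σ))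

      len-braid : ∀ x → len (word (alternating x (suc m))) ≤ m ∸ 1
      len-braid x = subst (len (word (alternating x (suc m))) ≤_) (length-alternating (other x) (m ∸ 1))
        (len-word≤ (alternating x (suc m)) (alternating (other x) (m ∸ 1)) (braid-≈ x))

      len-braid-++ : ∀ x r → len (word (alternating x (suc m ℕ.+ r))) ≤ (m ∸ 1) ℕ.+ r
      len-braid-++ x r = subst (len (word longer) ≤_) length≡ (len-word≤ longer shorter shorter≈)
        where
        rest = alternating (otherⁿ (suc m) x) r
        longer = alternating x (suc m ℕ.+ r)
        shorter = alternating (other x) (m ∸ 1) ++ rest
        shorter≈ : word shorter ≈ word longer
        shorter≈ = subst₂ _≈_ (sym (List.map-++ letter (alternating (other x) (m ∸ 1)) rest))
          (sym (trans (cong word (alternating-+ x (suc m) r)) (List.map-++ letter (alternating x (suc m)) rest)))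
          (≈-++ʳ (word rest) (word (alternating (other x) (m ∸ 1))) (word (alternating x (suc m))) (braid-≈ x))
        length≡ : length shorter ≡ (m ∸ 1) ℕ.+ r
        length≡ rewrite List.length-++ (alternating (other x) (m ∸ 1)) {rest}
                      | length-alternating (other x) (m ∸ 1) | length-alternating (otherⁿ (suc m) x) r = refl

    finite-type-positive : ∀ j → j ≤ len (word (alternating T j)) → j ≤ len (s ∷ word (alternating T j)) →
                           NonNeg₂ (run⁻¹ (alternating T j) initial)
    finite-type-positive j red red-s with ℕ.<-cmp j m
    ... | tri< j<m _ _ = positive j j<m
    ... | tri≈ _ refl _ = subst (λ n → NonNeg₂ (run⁻¹ (alternating T n) initial)) (sym m≡0) (+≤+ z≤n , +≤+ z≤n)
      where
      n≤n∸1⇒n≡0 : ∀ {n} → n ≤ n ∸ 1 → n ≡ 0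
      n≤n∸1⇒n≡0 {zero}  _ = refl
      n≤n∸1⇒n≡0 {suc n} n<n = contradiction n<n (ℕP.n≮n n)
      m≡0 : m ≡ 0
      m≡0 = n≤n∸1⇒n≡0 (ℕP.≤-trans red-s (len-braid S))
    ... | tri> _ _ m<j with r , refl ← ℕP.m≤n⇒∃[o]m+o≡n m<j =
      contradiction (ℕP.≤-trans red (len-braid-++ T r)) (ℕP.<⇒≱ (ℕP.+-monoˡ-< r (s≤s (ℕP.m∸n≤m m 1))))

  private
    zero-symmetric : ∀ i j → ℤ.∣ M i j ∣ ≡ 0 → ℤ.∣ M j i ∣ ≡ 0
    zero-symmetric i j ∣Mij∣≡0 = cong ℤ.∣_∣ (zeroSym i j (ℤP.∣i∣≡0⇒i≡0 ∣Mij∣≡0))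

    M-st≡ : M s t ≡ - + ℤ.∣ M s t ∣
    M-st≡ = nonPos⇒≡-∣∣ (offdiag s t s≢t)

    M-ts≡ : M t s ≡ - + ℤ.∣ M t s ∣
    M-ts≡ = nonPos⇒≡-∣∣ (offdiag t s t≢s)

  alternating-positive : ∀ j → j ≤ len (word (alternating T j)) → j ≤ len (s ∷ word (alternating T j)) →
                         NonNeg₂ (run⁻¹ (alternating T j) initial)
  alternating-positive j red red-s
    with rank2-classification ℤ.∣ M s t ∣ ℤ.∣ M t s ∣ (zero-symmetric s t) (zero-symmetric t s)
  ... | inj₁ (m , finite) =
    finite-type-positive (subst₂ (λ a b → Rank2Action.FiniteType a b m) (sym M-st≡) (sym M-ts≡) finite) j red red-s
  ... | inj₂ 4≤pq =
    subst₂ (λ a b → NonNeg₂ (Rank2Action.run⁻¹ a b (alternating T j) (Rank2Action.initial a b)))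
           (sym M-st≡) (sym M-ts≡) (InfiniteType.positive ℤ.∣ M s t ∣ ℤ.∣ M t s ∣ 4≤pq j)

  dihedral-positive : ∀ y → length y ≤ len (word y) → length y ≤ len (s ∷ word y) → NonNeg₂ (run⁻¹ y initial)
  dihedral-positive []      _   _     = +≤+ z≤n , +≤+ z≤n
  dihedral-positive (S ∷ y) _   red-s = contradiction (ℕP.≤-trans red-s (len-repeated S y)) (ℕP.n≮n _)
  dihedral-positive (T ∷ y) red red-s =
    subst (λ z → NonNeg₂ (run⁻¹ z initial)) (sym alternates)
      (alternating-positive n (subst (λ z → n ≤ len (word z)) alternates red)
                              (subst (λ z → n ≤ len (s ∷ word z)) alternates red-s))
    where
    n = length (T ∷ y)
    alternates = alternating-if-reduced T y red

-- The Tits lemma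

module DihedralCosets {k : ℕ} (M : Matrix k) (M-GCM : IsGCM M) {s t : Fin k} (s≢t : s ≢ t) where

  open WeylGroup M M-GCM
  open Dihedral M M-GCM s≢t
  open Rank2Action (M s t) (M t s) using (run⁻¹; initial)

  Ascent : Fin k → Word k → Set
  Ascent j x = len x ≤ len (j ∷ x)

  record Factorisation (u : Word k) : Set where
    field
      prefix     : List Letter
      suffix     : Word k
      factorises : word prefix ++ suffix ≈ u
      additive   : length prefix ℕ.+ len suffix ≤ len u

  open Factorisation

  private
    extend : ∀ {u} x (F : Factorisation u) → len (letter x ∷ suffix F) < len (suffix F) → Factorisation u
    extend {u} x F descent = record
      { prefix     = prefix F ++ x ∷ []
      ; suffix     = l ∷ suffix F
      ; factorises = factorises′
      ; additive   = additive′
      }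
      where
      l = letter x
      factorises′ : word (prefix F ++ x ∷ []) ++ l ∷ suffix F ≈ u
      factorises′ = begin
        word (prefix F ++ x ∷ []) ++ l ∷ suffix F   ≡⟨ regroup ⟩
        word (prefix F) ++ l ∷ l ∷ suffix F         ≈⟨ ≈-++ˡ (word (prefix F)) (l ∷ l ∷ suffix F) (suffix F) (∷∷-cancel l (suffix F)) ⟩
        word (prefix F) ++ suffix F                 ≈⟨ factorises F ⟩
        u                                           ∎
        where
        open ≈-Reasoning
        regroup = trans (cong (_++ l ∷ suffix F) (List.map-++ letter (prefix F) (x ∷ [])))
                        (List.++-assoc (word (prefix F)) (l ∷ []) (l ∷ suffix F))
      additive′ : length (prefix F ++ x ∷ []) ℕ.+ len (l ∷ suffix F) ≤ len u
      additive′ = begin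
        length (prefix F ++ x ∷ []) ℕ.+ len (l ∷ suffix F)  ≡⟨ cong (ℕ._+ len (l ∷ suffix F)) (List.length-++ (prefix F)) ⟩
        length (prefix F) ℕ.+ 1 ℕ.+ len (l ∷ suffix F)      ≡⟨ ℕP.+-assoc (length (prefix F)) 1 (len (l ∷ suffix F)) ⟩
        length (prefix F) ℕ.+ suc (len (l ∷ suffix F))      ≤⟨ ℕP.+-monoʳ-≤ (length (prefix F)) descent ⟩
        length (prefix F) ℕ.+ len (suffix F)                ≤⟨ additive F ⟩
        len u                                               ∎
        where open ℕP.≤-Reasoning

    ascents-or-descent : ∀ x → (Ascent s x × Ascent t x) ⊎ Σ Letter λ l → len (letter l ∷ x) < len x
    ascents-or-descent x with len x ℕ.≤? len (s ∷ x) | len x ℕ.≤? len (t ∷ x)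
    ... | yes asc-s | yes asc-t = inj₁ (asc-s , asc-t)
    ... | no ¬asc-s | _         = inj₂ (S , ℕP.≰⇒> ¬asc-s)
    ... | yes _     | no ¬asc-t = inj₂ (T , ℕP.≰⇒> ¬asc-t)

  descend : ∀ n {u} (F : Factorisation u) → len (suffix F) ≤ n →
            Σ (Factorisation u) λ F′ → len (suffix F′) ≤ len (suffix F) × Ascent s (suffix F′) × Ascent t (suffix F′)
  descend zero    F x≤0 = F , ℕP.≤-refl , ℕP.≤-trans x≤0 z≤n , ℕP.≤-trans x≤0 z≤n
  descend (suc n) F x≤n with ascents-or-descent (suffix F)
  ... | inj₁ ascents = F , ℕP.≤-refl , ascents
  ... | inj₂ (l , descent) with descend n (extend l F descent) (ℕP.≤-pred (ℕP.≤-trans descent x≤n))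
  ...   | F′ , shrinks , ascents = F′ , ℕP.≤-trans shrinks (ℕP.<⇒≤ descent) , ascents

  through-t : ∀ {u} → len (t ∷ u) < len u → Factorisation u
  through-t {u} t-descent = record
    { prefix = T ∷ [] ; suffix = t ∷ u ; factorises = ∷∷-cancel t u ; additive = t-descent }

  -- Write u = y x with y in ⟨s, t⟩ and neither s nor t a left descent of x; then
  -- u⁻¹α_s = x⁻¹(y⁻¹α_s) is a nonnegative combination of x⁻¹α_s and x⁻¹α_t.
  ascent-positive-step : ∀ {u} → (∀ x → len x < len u → ∀ i → Ascent i x → NonNeg (act⁻¹ x (α i))) →
                         len (t ∷ u) < len u → Ascent s u → NonNeg (act⁻¹ u (α s))
  ascent-positive-step {u} IH t-descent s-ascent with descend (len (t ∷ u)) (through-t t-descent) ℕP.≤-refl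
  ... | F , shrinks , x-s-ascent , x-t-ascent =
    λ m → subst (+ 0 ℤ.≤_) (sym (root≡ m))
            (nonNeg-combination X≥0 Y≥0 (IH x x<u s x-s-ascent) (IH x x<u t x-t-ascent) m)
    where
    y = prefix F
    x = suffix F
    x<u : len x < len u
    x<u = ℕP.≤-<-trans shrinks t-descent
    u≈yx : u ≈ word y ++ x
    u≈yx = ≈-sym (word y ++ x) u (factorises F)
    reduced : length y ≤ len (word y)
    reduced = ℕP.+-cancelʳ-≤ (len x) (length y) (len (word y)) (begin
      length y ℕ.+ len x          ≤⟨ additive F ⟩
      len u                       ≡⟨ len-≈ u (word y ++ x) u≈yx ⟩
      len (word y ++ x)           ≤⟨ len-++ (word y) x ⟩
      len (word y) ℕ.+ len x      ∎)
      where open ℕP.≤-Reasoning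
    s-reduced : length y ≤ len (s ∷ word y)
    s-reduced = ℕP.+-cancelʳ-≤ (len x) (length y) (len (s ∷ word y)) (begin
      length y ℕ.+ len x          ≤⟨ additive F ⟩
      len u                       ≤⟨ s-ascent ⟩
      len (s ∷ u)                 ≡⟨ len-≈ (s ∷ u) (s ∷ word y ++ x) (≈-∷ s u (word y ++ x) u≈yx) ⟩
      len (s ∷ word y ++ x)       ≤⟨ len-++ (s ∷ word y) x ⟩
      len (s ∷ word y) ℕ.+ len x  ∎)
      where open ℕP.≤-Reasoning
    σ = run⁻¹ y initial
    X≥0 = proj₁ (dihedral-positive y reduced s-reduced)
    Y≥0 = proj₂ (dihedral-positive y reduced s-reduced)
    root≡ : act⁻¹ u (α s) ≗ cₛ σ ⊙ act⁻¹ x (α s) ⊕ cₜ σ ⊙ act⁻¹ x (α t)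
    root≡ m = begin
      act⁻¹ u (α s) m                                  ≡⟨ ≈⇒act⁻¹ u (word y ++ x) u≈yx (α s) m ⟩
      act⁻¹ (word y ++ x) (α s) m                      ≡⟨ cong (λ c → c m) (act⁻¹-++ (word y) x (α s)) ⟩
      act⁻¹ x (act⁻¹ (word y) (α s)) m                 ≡⟨ act⁻¹-cong x (act⁻¹-α y) m ⟩
      act⁻¹ x (cₛ σ ⊙ α s ⊕ cₜ σ ⊙ α t) m             ≡⟨ Linear.combination (act⁻¹-linear x) (cₛ σ) (cₜ σ) (α s) (α t) m ⟩
      (cₛ σ ⊙ act⁻¹ x (α s) ⊕ cₜ σ ⊙ act⁻¹ x (α t)) m  ∎
      where open ≡-Reasoning

module TitsLemma {k : ℕ} (M : Matrix k) (M-GCM : IsGCM M) where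

  open WeylGroup M M-GCM

  private
    first-letter-descent : ∀ t r u → t ∷ r ≈ u → length (t ∷ r) ≡ len u → len (t ∷ u) < len u
    first-letter-descent t r u tr≈u |tr| = subst (len (t ∷ u) <_) |tr| (s≤s (len-minimal r (t ∷ u) r≈tu))
      where
      r≈tu : r ≈ t ∷ u
      r≈tu = ≈-trans r (t ∷ t ∷ r) (t ∷ u) (≈-sym (t ∷ t ∷ r) r (∷∷-cancel t r)) (≈-∷ t (t ∷ r) u tr≈u)

    bounded : ∀ N u j → len u < N → len u ≤ len (j ∷ u) → NonNeg (act⁻¹ u (α j))
    bounded (suc N) u j u<N j-ascent with len-witness u
    ... | [] , _ , []≈u = λ m → subst (+ 0 ℤ.≤_) (≈⇒act⁻¹ [] u []≈u (α j) m) (α-nonNeg j m)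
    ... | t ∷ r , |tr| , tr≈u with j ≟ t
    ...   | yes refl = contradiction (ℕP.≤-<-trans j-ascent (first-letter-descent t r u tr≈u |tr|)) (ℕP.n≮n (len u))
    ...   | no j≢t = DihedralCosets.ascent-positive-step M M-GCM j≢t IH (first-letter-descent t r u tr≈u |tr|) j-ascent
      where
      IH : ∀ x → len x < len u → ∀ i → len x ≤ len (i ∷ x) → NonNeg (act⁻¹ x (α i))
      IH x x<u i = bounded N x i (ℕP.<-≤-trans x<u (ℕP.≤-pred u<N))

  positive-if-ascent : ∀ u j → len u ≤ len (j ∷ u) → NonNeg (act⁻¹ u (α j))
  positive-if-ascent u j = bounded (suc (len u)) u j ℕP.≤-refl

-- Roots and the left weak order

module Roots {k : ℕ} (M : Matrix k) (M-GCM : IsGCM M) where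

  open WeylGroup M M-GCM
  open TitsLemma M M-GCM public

  act⁻¹-∷-α : ∀ u j → act⁻¹ (j ∷ u) (α j) ≗ -1ℤ ⊙ act⁻¹ u (α j)
  act⁻¹-∷-α u j m = trans (act⁻¹-cong u (sref-α j) m) (Linear.homogeneous (act⁻¹-linear u) -1ℤ (α j) m)

  nonPos-if-descent : ∀ u j → len (j ∷ u) ≤ len u → NonPos (act⁻¹ u (α j))
  nonPos-if-descent u j j-descent = -1⊙-nonNeg⇒nonPos (λ m →
    subst (+ 0 ℤ.≤_) (act⁻¹-∷-α u j m) (positive-if-ascent (j ∷ u) j ascent m))
    where
    ascent : len (j ∷ u) ≤ len (j ∷ j ∷ u)
    ascent = subst (len (j ∷ u) ≤_) (sym (len-≈ (j ∷ j ∷ u) u (∷∷-cancel j u))) j-descent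

  dichotomy : ∀ u j → NonNeg (act⁻¹ u (α j)) ⊎ NonPos (act⁻¹ u (α j))
  dichotomy u j with len u ℕ.≤? len (j ∷ u)
  ... | yes ascent     = inj₁ (positive-if-ascent u j ascent)
  ... | no ¬ascent     = inj₂ (nonPos-if-descent u j (ℕP.<⇒≤ (ℕP.≰⇒> ¬ascent)))

  act⁻¹-α≢0 : ∀ u j → ¬ (act⁻¹ u (α j) ≗ 0ᴸ)
  act⁻¹-α≢0 u j root≗0 = α≢0 j (λ m → begin
    α j m                       ≡⟨ act-act⁻¹ u (α j) m ⟨
    act M u (act⁻¹ u (α j)) m   ≡⟨ act-cong u root≗0 m ⟩
    act M u 0ᴸ m                ≡⟨ Linear.preserves-0 (act-linear u) m ⟩
    + 0                         ∎)
    where open ≡-Reasoning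

  len-∷-if-positive : ∀ u j → NonNeg (act⁻¹ u (α j)) → len (j ∷ u) ≡ suc (len u)
  len-∷-if-positive u j positive with len (j ∷ u) ℕ.≤? len u
  ... | no ¬descent = ℕP.≤-antisym (len-∷ j u) (ℕP.≰⇒> ¬descent)
  ... | yes descent = contradiction (λ m → ℤP.≤-antisym (nonPos-if-descent u j descent m) (positive m))
                                    (act⁻¹-α≢0 u j)

  cover-if-positive : ∀ u j → NonNeg (act⁻¹ u (α j)) → Cover M u (j ∷ u)
  cover-if-positive u j positive =
    j , ≈-refl (j ∷ u) , len u , hasLength-len u ,
    subst (HasLength M (j ∷ u)) (len-∷-if-positive u j positive) (hasLength-len (j ∷ u))

  cover-len : ∀ u x → Cover M u x → len x ≡ suc (len u)
  cover-len u x (_ , _ , _ , u-has-n , x-has-1+n) = trans (sym (hasLength⇒len x-has-1+n)) (cong suc (hasLength⇒len u-has-n))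

  positive-if-cover : ∀ u x → Cover M u x → Σ (Fin k) λ j → x ≈ j ∷ u × NonNeg (act⁻¹ u (α j))
  positive-if-cover u x cover@(j , x≈ju , _) =
    j , x≈ju , positive-if-ascent u j (ℕP.≤-trans (ℕP.n≤1+n (len u)) (ℕP.≤-reflexive 1+len-u≡))
    where
    1+len-u≡ : suc (len u) ≡ len (j ∷ u)
    1+len-u≡ = trans (sym (cover-len u x cover)) (len-≈ x (j ∷ u) x≈ju)

  Root : RootLattice k → Set
  Root γ = Σ (Word k) λ u → Σ (Fin k) λ l → γ ≗ act⁻¹ u (α l)

  root-dichotomy : ∀ {γ} → Root γ → NonNeg γ ⊎ NonPos γ
  root-dichotomy {γ} (u , l , γ≗) with dichotomy u l
  ... | inj₁ positive = inj₁ (λ m → subst (+ 0 ℤ.≤_) (sym (γ≗ m)) (positive m))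
  ... | inj₂ negative = inj₂ (λ m → subst (ℤ._≤ + 0) (sym (γ≗ m)) (negative m))

  root≢0 : ∀ {γ} → Root γ → ¬ (γ ≗ 0ᴸ)
  root≢0 (u , l , γ≗) γ≗0 = act⁻¹-α≢0 u l (λ m → trans (sym (γ≗ m)) (γ≗0 m))

  root-act : ∀ w {γ} → Root γ → Root (act M w γ)
  root-act []      root = root
  root-act (j ∷ w) root with root-act w root
  ... | u , l , γ≗ = u ++ j ∷ [] , l , λ m →
    trans (sref-cong j γ≗ m) (sym (cong (λ c → c m) (act⁻¹-++ u (j ∷ []) (α l))))

  -- If u β ≤ 0 but s_j u β ≥ 0 then u β is a multiple of α_j, making β a nonpositive multiple of u⁻¹α_j.
  inversion-persists-step : ∀ u j β → NonNeg (act⁻¹ u (α j)) → Root β → NonNeg β →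
                            NonPos (act M u β) → NonPos (act M (j ∷ u) β)
  inversion-persists-step u j β positive root β≥0 uβ≤0 with root-dichotomy (root-act (j ∷ u) root)
  ... | inj₂ sjuβ≤0 = sjuβ≤0
  ... | inj₁ sjuβ≥0 = contradiction (λ m → ℤP.≤-antisym (β≤0 m) (β≥0 m)) (root≢0 root)
    where
    γ = act M u β
    γ≗ : γ ≗ γ j ⊙ α j
    γ≗ m with m ≟ j
    ... | yes refl = sym (ℤP.*-identityʳ (γ m))
    ... | no m≢j   = trans (ℤP.≤-antisym (uβ≤0 m) (subst (+ 0 ℤ.≤_) (sref-other j γ m≢j) (sjuβ≥0 m)))
                           (sym (ℤP.*-zeroʳ (γ j)))
    β≤0 : NonPos β
    β≤0 m = subst (ℤ._≤ + 0) (sym β≡) (nonPos-*-nonNeg (uβ≤0 j) (positive m))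
      where
      β≡ : β m ≡ γ j * act⁻¹ u (α j) m
      β≡ = trans (sym (act⁻¹-act u β m))
                 (trans (act⁻¹-cong u γ≗ m) (Linear.homogeneous (act⁻¹-linear u) (γ j) (α j) m))

  inversions-persist : ∀ {u w} → WeakLe M u w → ∀ β → Root β → NonNeg β →
                       NonPos (act M u β) → NonPos (act M w β)
  inversions-persist (wrefl u≈w) β root β≥0 uβ≤0 m = subst (ℤ._≤ + 0) (u≈w β m) (uβ≤0 m)
  inversions-persist {u} (wstep {x = x} cover x≤w) β root β≥0 uβ≤0 with positive-if-cover u x cover
  ... | j , x≈ju , positive = inversions-persist x≤w β root β≥0 (λ m →
    subst (ℤ._≤ + 0) (sym (x≈ju β m)) (inversion-persists-step u j β positive root β≥0 uβ≤0 m))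

  hasLength-≈ : ∀ u u′ {n} → u′ ≈ u → HasLength M u n → HasLength M u′ n
  hasLength-≈ u u′ u′≈u ((v , v≈u , |v|) , n-minimal) =
    (v , ≈-trans v u u′ v≈u (≈-sym u′ u u′≈u) , |v|) , λ v′ v′≈u′ → n-minimal v′ (≈-trans v′ u′ u v′≈u′ u′≈u)

  cover-≈ˡ : ∀ u u′ x → u′ ≈ u → Cover M u x → Cover M u′ x
  cover-≈ˡ u u′ x u′≈u (j , x≈ju , n , u-has-n , x-has-1+n) =
    j , ≈-trans x (j ∷ u) (j ∷ u′) x≈ju (≈-∷ j u u′ (≈-sym u′ u u′≈u)) , n , hasLength-≈ u u′ u′≈u u-has-n , x-has-1+n

  WeakLe-≈ˡ : ∀ u u′ {w} → u′ ≈ u → WeakLe M u w → WeakLe M u′ w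
  WeakLe-≈ˡ u u′ {w} u′≈u (wrefl u≈w)           = wrefl (≈-trans u′ u w u′≈u u≈w)
  WeakLe-≈ˡ u u′     u′≈u (wstep {x = x} c x≤w) = wstep {x = x} (cover-≈ˡ u u′ x u′≈u c) x≤w

  WeakLe-trans : ∀ {u v w} → WeakLe M u v → WeakLe M v w → WeakLe M u w
  WeakLe-trans {u} {v} (wrefl u≈v) v≤w = WeakLe-≈ˡ v u u≈v v≤w
  WeakLe-trans (wstep {x = x} c x≤v) v≤w = wstep {x = x} c (WeakLe-trans x≤v v≤w)

  WeakLe-≈ʳ : ∀ {u v w} → WeakLe M u v → v ≈ w → WeakLe M u w
  WeakLe-≈ʳ {v = v} {w} u≤v v≈w = WeakLe-trans u≤v (wrefl {u = v} {w = w} v≈w)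

-- Products of orthogonal reflections

module OrthogonalReflections {k : ℕ} (M : Matrix k) (M-GCM : IsGCM M) where

  open WeylGroup M M-GCM

  sref-comm : ∀ j l → M j l ≡ + 0 → M l j ≡ + 0 → ∀ c → sref M j (sref M l c) ≗ sref M l (sref M j c)
  sref-comm j l Mjl≡0 Mlj≡0 c m = begin
    sref M j (sref M l c) m                                      ≡⟨ unfold j l Mjl≡0 ⟩
    c m + (- coroot l c) * α l m + (- coroot j c) * α j m       ≡⟨ swap (c m) (coroot l c) (coroot j c) (α l m) (α j m) ⟩
    c m + (- coroot j c) * α j m + (- coroot l c) * α l m       ≡⟨ unfold l j Mlj≡0 ⟨
    sref M l (sref M j c) m                                      ∎
    where
    open ≡-Reasoning
    swap : ∀ c x y a b → c + (- x) * a + (- y) * b ≡ c + (- y) * b + (- x) * a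
    swap = solve-∀
    unfold : ∀ j l → M j l ≡ + 0 → sref M j (sref M l c) m ≡ c m + (- coroot l c) * α l m + (- coroot j c) * α j m
    unfold j l Mjl≡0 = trans (sref-≡ j (sref M l c) m)
      (cong₂ (λ x y → x + (- y) * α j m) (sref-≡ l c m) (coroot-sref-orthogonal j l c Mjl≡0))

  record Orthogonal (L : Word k) : Set where
    field
      distinct   : Unique L
      orthogonal : ∀ {j l} → j ∈ L → l ∈ L → j ≢ l → M j l ≡ + 0

  open Orthogonal

  private
    tail : ∀ {j L} → Orthogonal (j ∷ L) → Orthogonal L
    tail O = record { distinct = distinct-tail (distinct O) ; orthogonal = λ j∈ l∈ → orthogonal O (there j∈) (there l∈) }
      where
      distinct-tail : ∀ {j L} → Unique (j ∷ L) → Unique L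
      distinct-tail (_ ∷ unique) = unique

    head∉ : ∀ {j L} → Orthogonal (j ∷ L) → j ∉ L
    head∉ O with distinct O
    ... | j≢L ∷ _ = All¬⇒¬Any j≢L

    head≢ : ∀ {j l L} → Orthogonal (j ∷ L) → l ∈ L → j ≢ l
    head≢ O l∈L refl = head∉ O l∈L

    act-sref-comm : ∀ L j → (∀ {l} → l ∈ L → M j l ≡ + 0 × M l j ≡ + 0) → ∀ c → act M L (sref M j c) ≗ sref M j (act M L c)
    act-sref-comm []      j ⊥L c m = refl
    act-sref-comm (l ∷ L) j ⊥L c m = begin
      sref M l (act M L (sref M j c)) m   ≡⟨ sref-cong l (act-sref-comm L j (⊥L ∘ there) c) m ⟩
      sref M l (sref M j (act M L c)) m   ≡⟨ sref-comm l j (proj₂ (⊥L (here refl))) (proj₁ (⊥L (here refl))) (act M L c) m ⟩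
      sref M j (sref M l (act M L c)) m   ∎
      where
      open ≡-Reasoning
      open import Function using (_∘_)

  act⁻¹≗act : ∀ {L} → Orthogonal L → ∀ c → act⁻¹ L c ≗ act M L c
  act⁻¹≗act {[]}    O c m = refl
  act⁻¹≗act {j ∷ L} O c m = trans (act⁻¹≗act (tail O) (sref M j c) m) (act-sref-comm L j ⊥L c m)
    where
    ⊥L : ∀ {l} → l ∈ L → M j l ≡ + 0 × M l j ≡ + 0
    ⊥L l∈L = orthogonal O (here refl) (there l∈L) (head≢ O l∈L) ,
             orthogonal O (there l∈L) (here refl) (λ l≡j → head≢ O l∈L (sym l≡j))

  act-∉ : ∀ L c {x} → x ∉ L → act M L c x ≡ c x
  act-∉ []      c x∉L = refl
  act-∉ (l ∷ L) c x∉L = trans (sref-other l (act M L c) (λ x≡l → x∉L (here x≡l))) (act-∉ L c (λ x∈L → x∉L (there x∈L)))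

  coroot-act : ∀ j L c → (∀ {l} → l ∈ L → M j l ≡ + 0) → coroot j (act M L c) ≡ coroot j c
  coroot-act j []      c ⊥L = refl
  coroot-act j (l ∷ L) c ⊥L =
    trans (coroot-sref-orthogonal j l (act M L c) (⊥L (here refl))) (coroot-act j L c (λ l∈L → ⊥L (there l∈L)))

  act-∈ : ∀ {L} → Orthogonal L → ∀ c {x} → x ∈ L → act M L c x ≡ c x - coroot x c
  act-∈ {j ∷ L} O c (here refl) =
    trans (sref-same j (act M L c))
          (cong₂ _-_ (act-∉ L c (head∉ O)) (coroot-act j L c (λ l∈L → orthogonal O (here refl) (there l∈L) (head≢ O l∈L))))
  act-∈ {j ∷ L} O c (there x∈L) =
    trans (sref-other j (act M L c) (λ x≡j → head≢ O x∈L (sym x≡j))) (act-∈ (tail O) c x∈L)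

  same-elements-≈ : ∀ {L L′} → Orthogonal L → Orthogonal L′ →
                    (∀ {x} → x ∈ L → x ∈ L′) → (∀ {x} → x ∈ L′ → x ∈ L) → L ≈ L′
  same-elements-≈ {L} {L′} O O′ L⊆L′ L′⊆L c x with any? (x ≟_) L
  ... | yes x∈L = trans (act-∈ O c x∈L) (sym (act-∈ O′ c (L⊆L′ x∈L)))
  ... | no  x∉L = trans (act-∉ L c x∉L) (sym (act-∉ L′ c (λ x∈L′ → x∉L (L′⊆L x∈L′))))

  sref-fixes-α : ∀ l x → M l x ≡ + 0 → sref M l (α x) ≗ α x
  sref-fixes-α l x Mlx≡0 m = begin
    sref M l (α x) m                       ≡⟨ sref-≡ l (α x) m ⟩
    α x m + (- coroot l (α x)) * α l m     ≡⟨ cong (λ z → α x m + (- z) * α l m) (trans (coroot-α l x) Mlx≡0) ⟩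
    α x m + (- + 0) * α l m                ≡⟨ cong (_+_ (α x m)) (ℤP.*-zeroˡ (α l m)) ⟩
    α x m + + 0                            ≡⟨ ℤP.+-identityʳ (α x m) ⟩
    α x m                                  ∎
    where open ≡-Reasoning

  act-fixes-α : ∀ L x → (∀ {l} → l ∈ L → M l x ≡ + 0) → act M L (α x) ≗ α x
  act-fixes-α []      x ⊥L m = refl
  act-fixes-α (l ∷ L) x ⊥L m =
    trans (sref-cong l (act-fixes-α L x (λ l∈L → ⊥L (there l∈L))) m) (sref-fixes-α l x (⊥L (here refl)) m)

  act-α-∈ : ∀ {L} → Orthogonal L → ∀ {x} → x ∈ L → act M L (α x) ≗ -1ℤ ⊙ α x
  act-α-∈ {x ∷ L} O (here refl) m =
    trans (sref-cong x (act-fixes-α L x (λ l∈L → orthogonal O (there l∈L) (here refl) (λ l≡x → head≢ O l∈L (sym l≡x)))) m)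
          (sref-α x m)
  act-α-∈ {l ∷ L} O {x} (there x∈L) m = begin
    sref M l (act M L (α x)) m            ≡⟨ sref-cong l (act-α-∈ (tail O) x∈L) m ⟩
    sref M l (-1ℤ ⊙ α x) m           ≡⟨ Linear.homogeneous (sref-linear l) -1ℤ (α x) m ⟩
    -1ℤ * sref M l (α x) m           ≡⟨ cong (-1ℤ *_) (sref-fixes-α l x (orthogonal O (here refl) (there x∈L) (head≢ O x∈L)) m) ⟩
    -1ℤ * α x m                      ∎
    where open ≡-Reasoning

-- Folding

module _ {n : ℕ} where

  ∈elems⁺ : ∀ {X : Subset n} {j} → j ∈ₛ X → j ∈ elems X
  ∈elems⁺ {X} {j} j∈X = ∈.∈-filter⁺ (Subset._∈? X) (∈.∈-allFin j) j∈X

  ∈elems⁻ : ∀ {X : Subset n} {j} → j ∈ elems X → j ∈ₛ X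
  ∈elems⁻ {X} j∈ = proj₂ (∈.∈-filter⁻ (Subset._∈? X) {xs = allFin n} j∈)

  elems-unique : ∀ (X : Subset n) → Unique (elems X)
  elems-unique X = Unique.filter⁺ (Subset._∈? X) (Unique.allFin⁺ n)

  ∣∣-positive : ∀ {X : Subset n} {j} → j ∈ₛ X → 1 ≤ ∣ X ∣
  ∣∣-positive {X} {j} j∈X = subst (_≤ ∣ X ∣) (Subset.∣⁅x⁆∣≡1 j)
    (Subset.p⊆q⇒∣p∣≤∣q∣ (λ l∈⁅j⁆ → subst (_∈ₛ X) (sym (Subset.x∈⁅y⁆⇒x≡y j l∈⁅j⁆)) j∈X))

open CommutativeMonoidSum ℕP.*-1-commutativeMonoid using () renaming (sum to ∏; sum-remove to ∏-remove)

∏-positive : ∀ {k} (f : Fin k → ℕ) → (∀ i → 1 ≤ f i) → 1 ≤ ∏ f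
∏-positive {zero}  f f≥1 = s≤s z≤n
∏-positive {suc k} f f≥1 = ℕP.*-mono-≤ (f≥1 Fin.zero) (∏-positive (f ∘ Fin.suc) (f≥1 ∘ Fin.suc))

∏-except : ∀ {k} → (Fin k → ℕ) → Fin k → ℕ
∏-except {suc k} f i = ∏ (removeAt f i)

∏-except-positive : ∀ {k} (f : Fin k → ℕ) → (∀ i → 1 ≤ f i) → ∀ i → 1 ≤ ∏-except f i
∏-except-positive {suc k} f f≥1 i = ∏-positive (removeAt f i) (f≥1 ∘ Fin.punchIn i)

∏-except-* : ∀ {k} (f : Fin k → ℕ) i → f i ℕ.* ∏-except f i ≡ ∏ f
∏-except-* {suc k} f i = sym (∏-remove f)

module _ where

  *-cancelˡ-pos : ∀ {n} → 1 ≤ n → ∀ a b → + n * a ≡ + n * b → a ≡ b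
  *-cancelˡ-pos {suc n} _ a b = ℤP.*-cancelˡ-≡ (+ suc n) a b

  *-cancelˡ-nonPos : ∀ {n} → 1 ≤ n → ∀ a → + n * a ℤ.≤ + 0 → a ℤ.≤ + 0
  *-cancelˡ-nonPos {suc n} _ a na≤0 =
    ℤP.*-cancelˡ-≤-pos a (+ 0) (+ suc n) (subst (+ suc n * a ℤ.≤_) (sym (ℤP.*-zeroʳ (+ suc n))) na≤0)

  *-cancelˡ-nonNeg : ∀ {n} → 1 ≤ n → ∀ a → + 0 ℤ.≤ + n * a → + 0 ℤ.≤ a
  *-cancelˡ-nonNeg {suc n} _ a 0≤na =
    ℤP.*-cancelˡ-≤-pos (+ 0) a (+ suc n) (subst (ℤ._≤ + suc n * a) (sym (ℤP.*-zeroʳ (+ suc n))) 0≤na)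

  *-nonPos : ∀ n {a} → a ℤ.≤ + 0 → + n * a ℤ.≤ + 0
  *-nonPos n {a} a≤0 = subst (+ n * a ℤ.≤_) (ℤP.*-zeroʳ (+ n)) (ℤP.*-monoˡ-≤-nonNeg (+ n) a≤0)

module FoldingProperties {n m : ℕ} (F : Folding n m) where

  open Folding F
  open OrthogonalReflections B B-GCM
  open IsGCM B-GCM

  O : Fin m → Subset n
  O = Orbit orb

  ∈O⇒orb≡ : ∀ {i j} → j ∈ₛ O i → orb j ≡ i
  ∈O⇒orb≡ {i} {j} j∈O with orb j ≟ i | trans (sym (Vec.lookup∘tabulate (λ l → does (orb l ≟ i)) j)) (Vec.[]=⇒lookup j∈O)
  ... | yes orbj≡i | _ = orbj≡i
  ... | no _       | ()

  orb≡⇒∈O : ∀ {i j} → orb j ≡ i → j ∈ₛ O i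
  orb≡⇒∈O {i} {j} orbj≡i =
    Vec.lookup⇒[]= j (O i) (trans (Vec.lookup∘tabulate (λ l → does (orb l ≟ i)) j) (dec-true (orb j ≟ i) orbj≡i))

  orbit-orthogonal : ∀ {j l} → orb j ≡ orb l → j ≢ l → B j l ≡ + 0
  orbit-orthogonal {j} {l} orbj≡orbl = admiss j l (Equivalence.to (orb-orbit j l) orbj≡orbl)

  orbit-list-orthogonal : ∀ {L i} → Unique L → (∀ {j} → j ∈ L → orb j ≡ i) → Orthogonal L
  orbit-list-orthogonal unique in-orbit = record
    { distinct = unique
    ; orthogonal = λ j∈L l∈L → orbit-orthogonal (trans (in-orbit j∈L) (sym (in-orbit l∈L)))
    }

  subset-orthogonal : ∀ {X i} → X ⊆ O i → Orthogonal (elems X)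
  subset-orthogonal {X} X⊆O = orbit-list-orthogonal (elems-unique X) (∈O⇒orb≡ ∘ X⊆O ∘ ∈elems⁻)

  orbit-word-orthogonal : ∀ i → Orthogonal (elems (O i))
  orbit-word-orthogonal i = subset-orthogonal {i = i} (λ j∈O → j∈O)

  representative : ∀ i → Σ (Fin n) λ j → orb j ≡ i
  representative i = proj₁ (orb-surj i) , proj₂ (orb-surj i) refl

  o : Fin m → ℕ
  o i = ∣ O i ∣

  o-positive : ∀ i → 1 ≤ o i
  o-positive i = ∣∣-positive (orb≡⇒∈O (proj₂ (representative i)))

  rowsum : Fin n → Fin m → ℤ
  rowsum j i = ∑[ elems (O i) ] (B j)

  rowsum-own-orbit : ∀ {i j} → orb j ≡ i → rowsum j i ≡ + 2
  rowsum-own-orbit {i} {j} orbj≡i = trans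
    (∑[]-single (B j) (elems-unique (O i)) (∈elems⁺ (orb≡⇒∈O orbj≡i))
      (λ l∈O l≢j → orbit-orthogonal (trans orbj≡i (sym (∈O⇒orb≡ (∈elems⁻ l∈O)))) (λ j≡l → l≢j (sym j≡l))))
    (diag j)

  other-orbit-nonPos : ∀ {i j l} → orb j ≢ i → l ∈ elems (O i) → B j l ℤ.≤ + 0
  other-orbit-nonPos {i} {j} orbj≢i l∈O = offdiag j _ (λ { refl → orbj≢i (∈O⇒orb≡ (∈elems⁻ l∈O)) })

  rowsum-other-orbit : ∀ {i j} → orb j ≢ i → rowsum j i ℤ.≤ + 0
  rowsum-other-orbit {i} {j} orbj≢i = ∑[]-nonPos (elems (O i)) (B j) (other-orbit-nonPos orbj≢i)

  A-GCM : IsGCM A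
  A-GCM = record { diag = A-diag ; offdiag = A-offdiag ; zeroSym = A-zeroSym }
    where
    A-diag : ∀ i → A i i ≡ + 2
    A-diag i with j , orbj≡i ← representative i =
      *-cancelˡ-pos (o-positive i) (A i i) (+ 2) (trans (A-def i i j orbj≡i) (cong (+ o i *_) (rowsum-own-orbit orbj≡i)))
    A-offdiag : ∀ i′ i → i′ ≢ i → A i′ i ℤ.≤ + 0
    A-offdiag i′ i i′≢i with j , orbj≡i′ ← representative i′ =
      *-cancelˡ-nonPos (o-positive i) (A i′ i)
        (subst (ℤ._≤ + 0) (sym (A-def i′ i j orbj≡i′))
               (*-nonPos (o i′) (rowsum-other-orbit (λ orbj≡i → i′≢i (trans (sym orbj≡i′) orbj≡i)))))
    A-zeroSym : ∀ i′ i → A i′ i ≡ + 0 → A i i′ ≡ + 0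
    A-zeroSym i′ i Ai′i≡0 with i′ ≟ i
    ... | yes refl = Ai′i≡0
    ... | no i′≢i with j , orbj≡i ← representative i =
      *-cancelˡ-pos (o-positive i′) (A i i′) (+ 0) (begin
        + o i′ * A i i′       ≡⟨ A-def i i′ j orbj≡i ⟩
        + o i * rowsum j i′   ≡⟨ cong (+ o i *_) rowsum≡0 ⟩
        + o i * + 0           ≡⟨ ℤP.*-zeroʳ (+ o i) ⟩
        + 0                   ≡⟨ ℤP.*-zeroʳ (+ o i′) ⟨
        + o i′ * + 0          ∎)
      where
      open ≡-Reasoning
      rowsum≡0′ : ∀ {j′} → orb j′ ≡ i′ → rowsum j′ i ≡ + 0
      rowsum≡0′ {j′} orbj′≡i′ = *-cancelˡ-pos (o-positive i′) (rowsum j′ i) (+ 0) (begin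
        + o i′ * rowsum j′ i  ≡⟨ A-def i′ i j′ orbj′≡i′ ⟨
        + o i * A i′ i        ≡⟨ cong (+ o i *_) Ai′i≡0 ⟩
        + o i * + 0           ≡⟨ ℤP.*-zeroʳ (+ o i) ⟩
        + 0                   ≡⟨ ℤP.*-zeroʳ (+ o i′) ⟨
        + o i′ * + 0          ∎)
      B≡0 : ∀ {j′ l} → orb j′ ≡ i′ → orb l ≡ i → B l j′ ≡ + 0
      B≡0 {j′} {l} orbj′≡i′ orbl≡i = zeroSym j′ l
        (∑[]-nonPos-zero (elems (O i)) (B j′) (other-orbit-nonPos (λ orbj′≡i → i′≢i (trans (sym orbj′≡i′) orbj′≡i)))
                         (rowsum≡0′ orbj′≡i′) (∈elems⁺ (orb≡⇒∈O orbl≡i)))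
      rowsum≡0 : rowsum j i′ ≡ + 0
      rowsum≡0 = trans (∑[]-cong-∈ (elems (O i′)) (λ l∈O → B≡0 (∈O⇒orb≡ (∈elems⁻ l∈O)) orbj≡i))
                       (∑[]-zero (elems (O i′)))

  module WA = WeylGroup A A-GCM
  module WB = WeylGroup B B-GCM

  indicator : Subset n → Fin n → ℤ
  indicator X l = if does (l Subset.∈? X) then + 1 else + 0

  indicator-O : ∀ i l → indicator (O i) l ≡ α i (orb l)
  indicator-O i l with l Subset.∈? O i | orb l ≟ i
  ... | yes _   | yes _       = refl
  ... | no  _   | no  _       = refl
  ... | yes l∈O | no orbl≢i   = contradiction (∈O⇒orb≡ l∈O) orbl≢i
  ... | no  l∉O | yes orbl≡i  = contradiction (orb≡⇒∈O orbl≡i) l∉O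

  ∑-partition : ∀ (G : Fin n → ℤ) → ∑ G ≡ ∑ (λ i → ∑[ elems (O i) ] G)
  ∑-partition G = sym (begin
    ∑ (λ i → ∑[ elems (O i) ] G)                      ≡⟨ ∑-cong (λ i → ∑[]-filter (Subset._∈? O i) (allFin n) G) ⟩
    ∑ (λ i → ∑ (λ l → indicator (O i) l * G l))       ≡⟨ ∑[]-swap (allFin m) (allFin n) (λ i l → indicator (O i) l * G l) ⟩
    ∑ (λ l → ∑ (λ i → indicator (O i) l * G l))       ≡⟨ ∑-cong (λ l → trans (∑-cong (own-orbit l)) (∑-α (λ _ → G l) (orb l))) ⟩
    ∑ G                                               ∎)
    where
    open ≡-Reasoning
    own-orbit : ∀ l i → indicator (O i) l * G l ≡ G l * α (orb l) i
    own-orbit l i = trans (cong (_* G l) (trans (indicator-O i l) (α-comm i (orb l)))) (ℤP.*-comm (α (orb l) i) (G l))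

  -- μ_i = ∏_{i′ ≠ i} o_{i′}, so that o_i μ_i does not depend on i
  μ : Fin m → ℕ
  μ = ∏-except o

  μ-positive : ∀ i → 1 ≤ μ i
  μ-positive = ∏-except-positive o o-positive

  rowsum-weighted : ∀ {i j} → orb j ≡ i → ∀ i′ → + μ i′ * rowsum j i′ ≡ + μ i * A i i′
  rowsum-weighted {i} {j} orbj≡i i′ = *-cancelˡ-pos (o-positive i′) _ _ (begin
    + o i′ * (+ μ i′ * rowsum j i′)     ≡⟨ ℤP.*-assoc (+ o i′) (+ μ i′) (rowsum j i′) ⟨
    + o i′ * + μ i′ * rowsum j i′       ≡⟨ cong (_* rowsum j i′) (trans (oμ i′) (sym (oμ i))) ⟩
    + o i * + μ i * rowsum j i′         ≡⟨ rearrange (+ o i) (+ μ i) (rowsum j i′) ⟩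
    + μ i * (+ o i * rowsum j i′)       ≡⟨ cong (+ μ i *_) (A-def i i′ j orbj≡i) ⟨
    + μ i * (+ o i′ * A i i′)           ≡⟨ rearrange′ (+ μ i) (+ o i′) (A i i′) ⟩
    + o i′ * (+ μ i * A i i′)           ∎)
    where
    open ≡-Reasoning
    oμ : ∀ i → + o i * + μ i ≡ + ∏ o
    oμ i = trans (sym (ℤP.pos-* (o i) (μ i))) (cong +_ (∏-except-* o i))
    rearrange : ∀ a b c → a * b * c ≡ b * (a * c)
    rearrange = solve-∀
    rearrange′ : ∀ a b c → a * (b * c) ≡ b * (a * c)
    rearrange′ = solve-∀

  ι : RootLattice m → RootLattice n
  ι c j = + μ (orb j) * c (orb j)

  coroot-ι : ∀ {i j} → orb j ≡ i → ∀ c → WB.coroot j (ι c) ≡ + μ i * WA.coroot i c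
  coroot-ι {i} {j} orbj≡i c = begin
    ∑ (λ l → B j l * ι c l)                                          ≡⟨ ∑-partition (λ l → B j l * ι c l) ⟩
    ∑ (λ i′ → ∑[ elems (O i′) ] (λ l → B j l * ι c l))              ≡⟨ ∑-cong (λ i′ → ∑[]-cong-∈ (elems (O i′)) (in-orbit i′)) ⟩
    ∑ (λ i′ → ∑[ elems (O i′) ] (λ l → (+ μ i′ * c i′) * B j l))    ≡⟨ ∑-cong (λ i′ → ∑[]-*ˡ (elems (O i′)) (+ μ i′ * c i′) (B j)) ⟩
    ∑ (λ i′ → (+ μ i′ * c i′) * rowsum j i′)                        ≡⟨ ∑-cong weighted ⟩
    ∑ (λ i′ → + μ i * (A i i′ * c i′))                               ≡⟨ ∑-*ˡ (+ μ i) (λ i′ → A i i′ * c i′) ⟩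
    + μ i * WA.coroot i c                                            ∎
    where
    open ≡-Reasoning
    in-orbit : ∀ i′ {l} → l ∈ elems (O i′) → B j l * ι c l ≡ (+ μ i′ * c i′) * B j l
    in-orbit i′ {l} l∈O rewrite ∈O⇒orb≡ (∈elems⁻ l∈O) = ℤP.*-comm (B j l) (+ μ i′ * c i′)
    weighted : ∀ i′ → (+ μ i′ * c i′) * rowsum j i′ ≡ + μ i * (A i i′ * c i′)
    weighted i′ = begin
      (+ μ i′ * c i′) * rowsum j i′    ≡⟨ exchange (+ μ i′) (c i′) (rowsum j i′) ⟩
      (+ μ i′ * rowsum j i′) * c i′    ≡⟨ cong (_* c i′) (rowsum-weighted orbj≡i i′) ⟩
      (+ μ i * A i i′) * c i′          ≡⟨ ℤP.*-assoc (+ μ i) (A i i′) (c i′) ⟩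
      + μ i * (A i i′ * c i′)          ∎
      where
      exchange : ∀ a b c → (a * b) * c ≡ (a * c) * b
      exchange = solve-∀

  intertwine : ∀ i c → act B (elems (O i)) (ι c) ≗ ι (sref A i c)
  intertwine i c x with orb x ≟ i
  ... | yes refl = trans (act-∈ (orbit-word-orthogonal i) (ι c) (∈elems⁺ (orb≡⇒∈O refl)))
                         (trans (cong (_-_ (ι c x)) (coroot-ι refl c)) (factor (+ μ (orb x)) (c (orb x)) (WA.coroot (orb x) c)))
    where
    factor : ∀ a b d → a * b - a * d ≡ a * (b - d)
    factor = solve-∀
  ... | no orbx≢i = act-∉ (elems (O i)) (ι c) (λ x∈O → orbx≢i (∈O⇒orb≡ (∈elems⁻ x∈O)))

  fword-intertwine : ∀ v c → WB.act⁻¹ (fword v) (ι c) ≗ ι (WA.act⁻¹ v c)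
  fword-intertwine []      c x = refl
  fword-intertwine (i ∷ v) c x = begin
    WB.act⁻¹ (elems (O i) ++ fword v) (ι c) x                 ≡⟨ cong (λ d → d x) (WB.act⁻¹-++ (elems (O i)) (fword v) (ι c)) ⟩
    WB.act⁻¹ (fword v) (WB.act⁻¹ (elems (O i)) (ι c)) x       ≡⟨ WB.act⁻¹-cong (fword v) block x ⟩
    WB.act⁻¹ (fword v) (ι (sref A i c)) x                     ≡⟨ fword-intertwine v (sref A i c) x ⟩
    ι (WA.act⁻¹ v (sref A i c)) x                             ∎
    where
    open ≡-Reasoning
    block : WB.act⁻¹ (elems (O i)) (ι c) ≗ ι (sref A i c)
    block y = trans (act⁻¹≗act (orbit-word-orthogonal i) (ι c) y) (intertwine i c y)

  permute : RootLattice n → RootLattice n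
  permute c y = c (π ⟨$⟩ˡ y)

  orb-π⁻¹ : ∀ y → orb (π ⟨$⟩ˡ y) ≡ orb y
  orb-π⁻¹ y = Equivalence.from (orb-orbit (π ⟨$⟩ˡ y) y) (1 , inverseʳ π)

  coroot-permute : ∀ y c → WB.coroot y (permute c) ≡ WB.coroot (π ⟨$⟩ˡ y) c
  coroot-permute y c = begin
    ∑ (λ l → B y l * c (π ⟨$⟩ˡ l))                                  ≡⟨ ∑-permute (λ l → B y l * c (π ⟨$⟩ˡ l)) π ⟩
    ∑ (λ l → B y (π ⟨$⟩ʳ l) * c (π ⟨$⟩ˡ (π ⟨$⟩ʳ l)))                ≡⟨ ∑-cong (λ l → cong₂ _*_ (reindex l) (cong c (inverseˡ π))) ⟩
    ∑ (λ l → B (π ⟨$⟩ˡ y) l * c l)                                  ∎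
    where
    open ≡-Reasoning
    reindex : ∀ l → B y (π ⟨$⟩ʳ l) ≡ B (π ⟨$⟩ˡ y) l
    reindex l = trans (cong (λ z → B z (π ⟨$⟩ʳ l)) (sym (inverseʳ π))) (π-inv (π ⟨$⟩ˡ y) l)

  orbit-act-permute : ∀ i c → act B (elems (O i)) (permute c) ≗ permute (act B (elems (O i)) c)
  orbit-act-permute i c y with orb y ≟ i
  ... | yes orby≡i = begin
    act B (elems (O i)) (permute c) y                   ≡⟨ act-∈ (orbit-word-orthogonal i) (permute c) (∈elems⁺ (orb≡⇒∈O orby≡i)) ⟩
    c (π ⟨$⟩ˡ y) - WB.coroot y (permute c)             ≡⟨ cong (_-_ (c (π ⟨$⟩ˡ y))) (coroot-permute y c) ⟩
    c (π ⟨$⟩ˡ y) - WB.coroot (π ⟨$⟩ˡ y) c              ≡⟨ act-∈ (orbit-word-orthogonal i) c (∈elems⁺ (orb≡⇒∈O (trans (orb-π⁻¹ y) orby≡i))) ⟨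
    act B (elems (O i)) c (π ⟨$⟩ˡ y)                    ∎
    where open ≡-Reasoning
  ... | no orby≢i = trans (act-∉ (elems (O i)) (permute c) (∉O orby≢i))
                          (sym (act-∉ (elems (O i)) c (∉O (λ orb≡i → orby≢i (trans (sym (orb-π⁻¹ y)) orb≡i)))))
    where
    ∉O : ∀ {x} → orb x ≢ i → x ∉ elems (O i)
    ∉O orbx≢i x∈O = orbx≢i (∈O⇒orb≡ (∈elems⁻ x∈O))

  fword-permute : ∀ v c → WB.act⁻¹ (fword v) (permute c) ≗ permute (WB.act⁻¹ (fword v) c)
  fword-permute []      c y = refl
  fword-permute (i ∷ v) c y = begin
    WB.act⁻¹ (elems (O i) ++ fword v) (permute c) y                 ≡⟨ cong (λ d → d y) (WB.act⁻¹-++ (elems (O i)) (fword v) (permute c)) ⟩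
    WB.act⁻¹ (fword v) (WB.act⁻¹ (elems (O i)) (permute c)) y       ≡⟨ WB.act⁻¹-cong (fword v) block y ⟩
    WB.act⁻¹ (fword v) (permute (WB.act⁻¹ (elems (O i)) c)) y       ≡⟨ fword-permute v (WB.act⁻¹ (elems (O i)) c) y ⟩
    WB.act⁻¹ (fword v) (WB.act⁻¹ (elems (O i)) c) (π ⟨$⟩ˡ y)        ≡⟨ cong (λ d → d (π ⟨$⟩ˡ y)) (WB.act⁻¹-++ (elems (O i)) (fword v) c) ⟨
    WB.act⁻¹ (elems (O i) ++ fword v) c (π ⟨$⟩ˡ y)                  ∎
    where
    open ≡-Reasoning
    orthogonal = orbit-word-orthogonal i
    block : WB.act⁻¹ (elems (O i)) (permute c) ≗ permute (WB.act⁻¹ (elems (O i)) c)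
    block y = begin
      WB.act⁻¹ (elems (O i)) (permute c) y           ≡⟨ act⁻¹≗act orthogonal (permute c) y ⟩
      act B (elems (O i)) (permute c) y              ≡⟨ orbit-act-permute i c y ⟩
      act B (elems (O i)) c (π ⟨$⟩ˡ y)               ≡⟨ act⁻¹≗act orthogonal c (π ⟨$⟩ˡ y) ⟨
      WB.act⁻¹ (elems (O i)) c (π ⟨$⟩ˡ y)            ∎

  α-π : ∀ j → α (π ⟨$⟩ʳ j) ≗ permute (α j)
  α-π j y with y ≟ π ⟨$⟩ʳ j | π ⟨$⟩ˡ y ≟ j
  ... | yes _     | yes _     = refl
  ... | no  _     | no  _     = refl
  ... | yes y≡πj  | no π⁻¹y≢j = contradiction (trans (cong (π ⟨$⟩ˡ_) y≡πj) (inverseˡ π)) π⁻¹y≢j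
  ... | no  y≢πj  | yes π⁻¹y≡j = contradiction (trans (sym (inverseʳ π)) (cong (π ⟨$⟩ʳ_) π⁻¹y≡j)) y≢πj

  nonPos-along-orbit : ∀ v {j l} → orb j ≡ orb l →
                       NonPos (WB.act⁻¹ (fword v) (α j)) → NonPos (WB.act⁻¹ (fword v) (α l))
  nonPos-along-orbit v {j} orbj≡orbl j-nonPos with Equivalence.to (orb-orbit j _) orbj≡orbl
  ... | t , refl = along t
    where
    along : ∀ t → NonPos (WB.act⁻¹ (fword v) (α (iter (π ⟨$⟩ʳ_) t j)))
    along zero    = j-nonPos
    along (suc t) y = subst (ℤ._≤ + 0) (sym (trans (WB.act⁻¹-cong (fword v) (α-π j′) y) (fword-permute v (α j′) y)))
                             (along t (π ⟨$⟩ˡ y))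
      where j′ = iter (π ⟨$⟩ʳ_) t j

  ι-α : ∀ i → ι (α i) ≗ + μ i ⊙ (λ y → ∑[ elems (O i) ] (λ j → α j y))
  ι-α i y = begin
    + μ (orb y) * α i (orb y)                        ≡⟨ μ-α (orb y) ⟩
    + μ i * α i (orb y)                              ≡⟨ cong (+ μ i *_) members ⟨
    + μ i * ∑[ elems (O i) ] (λ j → α j y)          ∎
    where
    open ≡-Reasoning
    μ-α : ∀ i′ → + μ i′ * α i i′ ≡ + μ i * α i i′
    μ-α i′ with i′ ≟ i
    ... | yes refl = refl
    ... | no  _    = trans (ℤP.*-zeroʳ (+ μ i′)) (sym (ℤP.*-zeroʳ (+ μ i)))
    members : ∑[ elems (O i) ] (λ j → α j y) ≡ α i (orb y)
    members = begin
      ∑[ elems (O i) ] (λ j → α j y)             ≡⟨ ∑[]-filter (Subset._∈? O i) (allFin n) (λ j → α j y) ⟩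
      ∑ (λ j → indicator (O i) j * α j y)        ≡⟨ ∑-cong (λ j → cong (indicator (O i) j *_) (α-comm j y)) ⟩
      ∑ (λ j → indicator (O i) j * α y j)        ≡⟨ ∑-α (indicator (O i)) y ⟩
      indicator (O i) y                          ≡⟨ indicator-O i y ⟩
      α i (orb y)                                ∎

  module RB = Roots B B-GCM

  -- The roots f(v)⁻¹α_j, j ∈ O_i, share a sign (π permutes them) and sum to ι(v⁻¹α_i) / μ_i ≥ 0.
  positive-transfer : ∀ v i → NonNeg (WA.act⁻¹ v (α i)) → ∀ {j} → orb j ≡ i →
                      NonNeg (WB.act⁻¹ (fword v) (α j))
  positive-transfer v i v⁻¹αᵢ≥0 {j} orbj≡i with RB.dichotomy (fword v) j
  ... | inj₁ positive = positive
  ... | inj₂ j-nonPos = contradiction root≗0 (RB.act⁻¹-α≢0 (fword v) j)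
    where
    L = elems (O i)
    r : Fin n → RootLattice n
    r j′ = WB.act⁻¹ (fword v) (α j′)
    nonPos : ∀ y {j′} → j′ ∈ L → r j′ y ℤ.≤ + 0
    nonPos y j′∈L = nonPos-along-orbit v (trans orbj≡i (sym (∈O⇒orb≡ (∈elems⁻ j′∈L)))) j-nonPos y
    μ∑≡ : ∀ y → + μ i * ∑[ L ] (λ j′ → r j′ y) ≡ ι (WA.act⁻¹ v (α i)) y
    μ∑≡ y = begin
      + μ i * ∑[ L ] (λ j′ → r j′ y)                                ≡⟨ cong (+ μ i *_) (F-linear.preserves-∑ L α y) ⟨
      + μ i * WB.act⁻¹ (fword v) (λ y → ∑[ L ] (λ j′ → α j′ y)) y  ≡⟨ F-linear.homogeneous (+ μ i) _ y ⟨
      WB.act⁻¹ (fword v) (+ μ i ⊙ (λ y → ∑[ L ] (λ j′ → α j′ y))) y ≡⟨ WB.act⁻¹-cong (fword v) (ι-α i) y ⟨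
      WB.act⁻¹ (fword v) (ι (α i)) y                                ≡⟨ fword-intertwine v (α i) y ⟩
      ι (WA.act⁻¹ v (α i)) y                                        ∎
      where
      open ≡-Reasoning
      module F-linear = Linear (WB.act⁻¹-linear (fword v))
    ∑≡0 : ∀ y → ∑[ L ] (λ j′ → r j′ y) ≡ + 0
    ∑≡0 y = ℤP.≤-antisym (∑[]-nonPos L (λ j′ → r j′ y) (nonPos y))
              (*-cancelˡ-nonNeg (μ-positive i) _ (subst (+ 0 ℤ.≤_) (sym (μ∑≡ y)) ι-nonNeg))
      where
      ι-nonNeg : + 0 ℤ.≤ ι (WA.act⁻¹ v (α i)) y
      ι-nonNeg = nonNeg-* (+≤+ (z≤n {μ (orb y)})) (v⁻¹αᵢ≥0 (orb y))
    root≗0 : r j ≗ 0ᴸ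
    root≗0 y = ∑[]-nonPos-zero L (λ j′ → r j′ y) (nonPos y) (∑≡0 y) (∈elems⁺ (orb≡⇒∈O orbj≡i))

-- The interval [f(v), f(s_i v)]

module Interval {n m : ℕ} (F : Folding n m) (v : Word m) (i : Fin m) (cover : Cover (Folding.A F) v (i ∷ v)) where

  open Folding F
  open FoldingProperties F
  open OrthogonalReflections B B-GCM
  open WB using (_≈_; ≈-refl; ≈-sym; ≈-trans; ≈-∷; ≈-++ʳ; ≈⇒act⁻¹; act⁻¹; act⁻¹-++; act⁻¹-cong; act⁻¹-linear;
                act-++; act-cong; act-act⁻¹; sref-cong; sref-α)
  open RB using (Root; act⁻¹-α≢0; cover-if-positive; positive-if-cover; inversions-persist;
                WeakLe-trans; WeakLe-≈ˡ; WeakLe-≈ʳ)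
  module RA = Roots A A-GCM

  u₀ : Word n
  u₀ = fword v

  orbit-positive : ∀ {j} → orb j ≡ i → NonNeg (act⁻¹ u₀ (α j))
  orbit-positive = positive-transfer v i (RA.positive-if-ascent v i ascent)
    where
    ascent : WA.len v ℕ.≤ WA.len (i ∷ v)
    ascent = ℕP.≤-trans (ℕP.n≤1+n (WA.len v)) (ℕP.≤-reflexive (sym (RA.cover-len v (i ∷ v) cover)))

  act-φ : ∀ O′ c → act B (φ v O′) (act⁻¹ u₀ c) ≗ act B (elems O′) c
  act-φ O′ c y = trans (cong (λ d → d y) (act-++ (elems O′) u₀ (act⁻¹ u₀ c))) (act-cong (elems O′) (act-act⁻¹ u₀ c) y)

  act⁻¹-φ : ∀ O′ → O′ ⊆ O i → ∀ c → act⁻¹ (φ v O′) c ≗ act⁻¹ u₀ (act B (elems O′) c)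
  act⁻¹-φ O′ O′⊆O c y = trans (cong (λ d → d y) (act⁻¹-++ (elems O′) u₀ c))
                              (act⁻¹-cong u₀ (act⁻¹≗act (subset-orthogonal O′⊆O) c) y)

  chain-up : ∀ L K → Unique (L ++ K) → (∀ {j} → j ∈ L ++ K → orb j ≡ i) → WeakLe B (K ++ u₀) (L ++ K ++ u₀)
  chain-up []      K _ _ = wrefl (≈-refl (K ++ u₀))
  chain-up (j ∷ L) K (j∉LK ∷ unique) in-orbit =
    WeakLe-trans (chain-up L K unique (in-orbit ∘ there))
                 (wstep {x = j ∷ L ++ K ++ u₀} (cover-if-positive (L ++ K ++ u₀) j positive) (wrefl (≈-refl (j ∷ L ++ K ++ u₀))))
    where
    orthogonal : Orthogonal (L ++ K)
    orthogonal = orbit-list-orthogonal unique (in-orbit ∘ there)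
    fixed : act B (L ++ K) (α j) ≗ α j
    fixed = act-fixes-α (L ++ K) j (λ l∈LK →
      orbit-orthogonal (trans (in-orbit (there l∈LK)) (sym (in-orbit (here refl)))) (λ l≡j → All.lookup j∉LK l∈LK (sym l≡j)))
    positive : NonNeg (act⁻¹ (L ++ K ++ u₀) (α j))
    positive y = subst (+ 0 ℤ.≤_) (sym root≡) (orbit-positive (in-orbit (here refl)) y)
      where
      root≡ : act⁻¹ (L ++ K ++ u₀) (α j) y ≡ act⁻¹ u₀ (α j) y
      root≡ = begin
        act⁻¹ (L ++ K ++ u₀) (α j) y                ≡⟨ cong (λ w → act⁻¹ w (α j) y) (List.++-assoc L K u₀) ⟨
        act⁻¹ ((L ++ K) ++ u₀) (α j) y              ≡⟨ cong (λ d → d y) (act⁻¹-++ (L ++ K) u₀ (α j)) ⟩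
        act⁻¹ u₀ (act⁻¹ (L ++ K) (α j)) y           ≡⟨ act⁻¹-cong u₀ (λ y → trans (act⁻¹≗act orthogonal (α j) y) (fixed y)) y ⟩
        act⁻¹ u₀ (α j) y                            ∎
        where open ≡-Reasoning

  φ-monotone : ∀ O₁ O₂ → O₁ ⊆ O₂ → O₂ ⊆ O i → WeakLe B (φ v O₁) (φ v O₂)
  φ-monotone O₁ O₂ O₁⊆O₂ O₂⊆O = WeakLe-≈ʳ (chain-up L K unique in-orbit) (begin
    L ++ K ++ u₀       ≡⟨ List.++-assoc L K u₀ ⟨
    (L ++ K) ++ u₀     ≈⟨ ≈-++ʳ u₀ (L ++ K) (elems O₂) LK≈O₂ ⟩
    elems O₂ ++ u₀     ∎)
    where
    open WB.≈-Reasoning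
    D = O₂ ∩ ∁ O₁
    L = elems D
    K = elems O₁
    ∈D⁻ : ∀ {x} → x ∈ L → x ∈ₛ O₂ × x ∉ₛ O₁
    ∈D⁻ x∈L with x∈O₂ , x∈∁O₁ ← Subset.x∈p∩q⁻ O₂ (∁ O₁) (∈elems⁻ x∈L) = x∈O₂ , Subset.x∈∁p⇒x∉p x∈∁O₁
    unique : Unique (L ++ K)
    unique = Unique.++⁺ (elems-unique D) (elems-unique O₁) (λ (x∈L , x∈K) → proj₂ (∈D⁻ x∈L) (∈elems⁻ x∈K))
    ∈O₂ : ∀ {x} → x ∈ L ++ K → x ∈ₛ O₂
    ∈O₂ x∈LK with ∈.∈-++⁻ L x∈LK
    ... | inj₁ x∈L = proj₁ (∈D⁻ x∈L)
    ... | inj₂ x∈K = O₁⊆O₂ (∈elems⁻ x∈K)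
    in-orbit : ∀ {x} → x ∈ L ++ K → orb x ≡ i
    in-orbit = ∈O⇒orb≡ ∘ O₂⊆O ∘ ∈O₂
    ∈LK : ∀ {x} → x ∈ elems O₂ → x ∈ L ++ K
    ∈LK {x} x∈O₂ with x Subset.∈? O₁
    ... | yes x∈O₁ = ∈.∈-++⁺ʳ L (∈elems⁺ x∈O₁)
    ... | no  x∉O₁ = ∈.∈-++⁺ˡ (∈elems⁺ (Subset.x∈p∩q⁺ (∈elems⁻ x∈O₂ , Subset.x∉p⇒x∈∁p x∉O₁)))
    LK≈O₂ : L ++ K ≈ elems O₂
    LK≈O₂ = same-elements-≈ (orbit-list-orthogonal unique in-orbit) (subset-orthogonal O₂⊆O) (∈elems⁺ ∘ ∈O₂) ∈LK

  private
    1≰0 : ¬ (+ 1 ℤ.≤ + 0)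
    1≰0 (+≤+ ())

    orbit-root : ∀ j → Root (act⁻¹ u₀ (α j))
    orbit-root j = u₀ , j , λ _ → refl

  φ-reflects : ∀ O₁ O₂ → O₁ ⊆ O i → WeakLe B (φ v O₁) (φ v O₂) → O₁ ⊆ O₂
  φ-reflects O₁ O₂ O₁⊆O φ₁≤φ₂ {x} x∈O₁ with x Subset.∈? O₂
  ... | yes x∈O₂ = x∈O₂
  ... | no  x∉O₂ = contradiction (subst (ℤ._≤ + 0) at-x (inverted₂ x)) 1≰0
    where
    β = act⁻¹ u₀ (α x)
    inverted₁ : NonPos (act B (φ v O₁) β)
    inverted₁ y = subst (ℤ._≤ + 0) (sym (trans (act-φ O₁ (α x) y) (act-α-∈ (subset-orthogonal O₁⊆O) (∈elems⁺ x∈O₁) y)))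
                        (nonNeg⇒-1⊙-nonPos (α-nonNeg x) y)
    inverted₂ : NonPos (act B (φ v O₂) β)
    inverted₂ = inversions-persist φ₁≤φ₂ β (orbit-root x) (orbit-positive (∈O⇒orb≡ (O₁⊆O x∈O₁))) inverted₁
    at-x : act B (φ v O₂) β x ≡ + 1
    at-x = trans (act-φ O₂ (α x) x) (trans (act-∉ (elems O₂) (α x) (x∉O₂ ∘ ∈elems⁻)) (α-same x))

  φ-injective : ∀ O₁ O₂ → O₁ ⊆ O i → O₂ ⊆ O i → φ v O₁ ≈ φ v O₂ → O₁ ≡ O₂
  φ-injective O₁ O₂ O₁⊆O O₂⊆O φ₁≈φ₂ = Subset.⊆-antisym
    (φ-reflects O₁ O₂ O₁⊆O (wrefl φ₁≈φ₂))
    (φ-reflects O₂ O₁ O₂⊆O (wrefl (≈-sym (φ v O₁) (φ v O₂) φ₁≈φ₂)))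

  φ-⊥ : u₀ ≈ φ v ⊥
  φ-⊥ = ≈-++ʳ u₀ [] (elems ⊥) (same-elements-≈ none (subset-orthogonal {i = i} (λ x∈⊥ → contradiction x∈⊥ Subset.∉⊥))
                                 (λ ()) (λ x∈⊥ → contradiction (∈elems⁻ x∈⊥) Subset.∉⊥))
    where
    none : Orthogonal []
    none = record { distinct = [] ; orthogonal = λ () }

  insert-⊆ : ∀ {j O′} → orb j ≡ i → O′ ⊆ O i → ⁅ j ⁆ ∪ O′ ⊆ O i
  insert-⊆ {j} {O′} orbj≡i O′⊆O x∈ with Subset.x∈p∪q⁻ ⁅ j ⁆ O′ x∈
  ... | inj₁ x∈⁅j⁆ = orb≡⇒∈O (trans (cong orb (Subset.x∈⁅y⁆⇒x≡y j x∈⁅j⁆)) orbj≡i)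
  ... | inj₂ x∈O′  = O′⊆O x∈O′

  φ-insert : ∀ {j O′} → orb j ≡ i → j ∉ₛ O′ → O′ ⊆ O i → j ∷ φ v O′ ≈ φ v (⁅ j ⁆ ∪ O′)
  φ-insert {j} {O′} orbj≡i j∉O′ O′⊆O =
    ≈-++ʳ u₀ (j ∷ elems O′) (elems (⁅ j ⁆ ∪ O′)) (same-elements-≈ orthogonal (subset-orthogonal ∪⊆O) to from)
    where
    j≢ : ∀ {l} → l ∈ elems O′ → j ≢ l
    j≢ l∈O′ j≡l = j∉O′ (subst (_∈ₛ O′) (sym j≡l) (∈elems⁻ l∈O′))
    orthogonal : Orthogonal (j ∷ elems O′)
    orthogonal = orbit-list-orthogonal (All.tabulate j≢ ∷ elems-unique O′)
                                       λ { (here refl) → orbj≡i ; (there l∈O′) → ∈O⇒orb≡ (O′⊆O (∈elems⁻ l∈O′)) }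
    ∪⊆O = insert-⊆ orbj≡i O′⊆O
    to : ∀ {x} → x ∈ j ∷ elems O′ → x ∈ elems (⁅ j ⁆ ∪ O′)
    to (here refl)  = ∈elems⁺ (Subset.x∈p∪q⁺ (inj₁ (Subset.x∈⁅x⁆ j)))
    to (there x∈O′) = ∈elems⁺ (Subset.x∈p∪q⁺ (inj₂ (∈elems⁻ x∈O′)))
    from : ∀ {x} → x ∈ elems (⁅ j ⁆ ∪ O′) → x ∈ j ∷ elems O′
    from x∈ with Subset.x∈p∪q⁻ ⁅ j ⁆ O′ (∈elems⁻ x∈)
    ... | inj₁ x∈⁅j⁆ = here (Subset.x∈⁅y⁆⇒x≡y j x∈⁅j⁆)
    ... | inj₂ x∈O′  = there (∈elems⁺ x∈O′)

  -- s_j with j ∉ O_i would create an inversion that f(s_i v) lacks; s_j with j ∈ O′ would undo one.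
  next-reflection : ∀ {x j} O′ → O′ ⊆ O i → x ≈ φ v O′ → NonNeg (act⁻¹ x (α j)) →
                    WeakLe B (j ∷ x) (fword (i ∷ v)) → orb j ≡ i × j ∉ₛ O′
  next-reflection {x} {j} O′ O′⊆O x≈φ positive jx≤z = in-orbit , fresh
    where
    β = act⁻¹ x (α j)
    β≗ : β ≗ act⁻¹ u₀ (act B (elems O′) (α j))
    β≗ y = trans (≈⇒act⁻¹ x (φ v O′) x≈φ (α j) y) (act⁻¹-φ O′ O′⊆O (α j) y)
    in-orbit : orb j ≡ i
    in-orbit with orb j ≟ i
    ... | yes orbj≡i = orbj≡i
    ... | no  orbj≢i = contradiction (subst (ℤ._≤ + 0) at-j (inverted-z j)) 1≰0
      where
      ∉orbit : ∀ {O″} → O″ ⊆ O i → j ∉ elems O″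
      ∉orbit O″⊆O j∈ = orbj≢i (∈O⇒orb≡ (O″⊆O (∈elems⁻ j∈)))
      inverted : NonPos (act B (j ∷ x) β)
      inverted y = subst (ℤ._≤ + 0) (sym (trans (sref-cong j (act-act⁻¹ x (α j)) y) (sref-α j y)))
                         (nonNeg⇒-1⊙-nonPos (α-nonNeg j) y)
      inverted-z : NonPos (act B (fword (i ∷ v)) β)
      inverted-z = inversions-persist jx≤z β (x , j , λ _ → refl) positive inverted
      at-j : act B (fword (i ∷ v)) β j ≡ + 1
      at-j = begin
        act B (elems (O i) ++ u₀) β j                          ≡⟨ cong (λ d → d j) (act-++ (elems (O i)) u₀ β) ⟩
        act B (elems (O i)) (act B u₀ β) j                     ≡⟨ act-∉ (elems (O i)) (act B u₀ β) (∉orbit (λ y∈O → y∈O)) ⟩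
        act B u₀ β j                                           ≡⟨ act-cong u₀ β≗ j ⟩
        act B u₀ (act⁻¹ u₀ (act B (elems O′) (α j))) j         ≡⟨ act-act⁻¹ u₀ (act B (elems O′) (α j)) j ⟩
        act B (elems O′) (α j) j                               ≡⟨ act-∉ (elems O′) (α j) (∉orbit O′⊆O) ⟩
        α j j                                                  ≡⟨ α-same j ⟩
        + 1                                                    ∎
        where open ≡-Reasoning
    fresh : j ∉ₛ O′
    fresh j∈O′ = act⁻¹-α≢0 x j (λ y → ℤP.≤-antisym (β≤0 y) (positive y))
      where
      β≗-α : β ≗ -1ℤ ⊙ act⁻¹ u₀ (α j)
      β≗-α y = begin
        β y                                           ≡⟨ β≗ y ⟩
        act⁻¹ u₀ (act B (elems O′) (α j)) y           ≡⟨ act⁻¹-cong u₀ (act-α-∈ (subset-orthogonal O′⊆O) (∈elems⁺ j∈O′)) y ⟩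
        act⁻¹ u₀ (-1ℤ ⊙ α j) y                   ≡⟨ Linear.homogeneous (act⁻¹-linear u₀) -1ℤ (α j) y ⟩
        (-1ℤ ⊙ act⁻¹ u₀ (α j)) y                 ∎
        where open ≡-Reasoning
      β≤0 : NonPos β
      β≤0 y = subst (ℤ._≤ + 0) (sym (β≗-α y)) (nonNeg⇒-1⊙-nonPos (orbit-positive in-orbit) y)

  ascend : ∀ {x w} O′ → O′ ⊆ O i → x ≈ φ v O′ → WeakLe B x w → WeakLe B w (fword (i ∷ v)) →
           Σ (Subset n) λ O″ → O″ ⊆ O i × φ v O″ ≈ w
  ascend {x} {w} O′ O′⊆O x≈φ (wrefl x≈w) _ = O′ , O′⊆O , ≈-trans (φ v O′) x w (≈-sym x (φ v O′) x≈φ) x≈w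
  ascend {x} O′ O′⊆O x≈φ (wstep {x = x′} x⋖x′ x′≤w) w≤z with positive-if-cover x x′ x⋖x′
  ... | j , x′≈jx , positive
    with orbj≡i , j∉O′ ← next-reflection O′ O′⊆O x≈φ positive
                           (WeakLe-≈ˡ x′ (j ∷ x) (≈-sym x′ (j ∷ x) x′≈jx) (WeakLe-trans x′≤w w≤z)) =
    ascend (⁅ j ⁆ ∪ O′) (insert-⊆ orbj≡i O′⊆O) x′≈φ x′≤w w≤z
    where
    open WB.≈-Reasoning
    x′≈φ : x′ ≈ φ v (⁅ j ⁆ ∪ O′)
    x′≈φ = begin
      x′                     ≈⟨ x′≈jx ⟩
      j ∷ x                  ≈⟨ ≈-∷ j x (φ v O′) x≈φ ⟩
      j ∷ φ v O′             ≈⟨ φ-insert orbj≡i j∉O′ O′⊆O ⟩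
      φ v (⁅ j ⁆ ∪ O′)       ∎

  ⊥⊆ : ∀ {X : Subset n} → ⊥ ⊆ X
  ⊥⊆ x∈⊥ = contradiction x∈⊥ Subset.∉⊥

  φ-in-interval : ∀ O′ → O′ ⊆ O i → InInterval B u₀ (fword (i ∷ v)) (φ v O′)
  φ-in-interval O′ O′⊆O =
    WeakLe-≈ˡ (φ v ⊥) u₀ φ-⊥ (φ-monotone ⊥ O′ ⊥⊆ O′⊆O) , φ-monotone O′ (O i) O′⊆O (λ x∈O → x∈O)

  φ-surjective : ∀ w → InInterval B u₀ (fword (i ∷ v)) w → Σ (Subset n) λ O′ → O′ ⊆ O i × φ v O′ ≈ w
  φ-surjective w (u₀≤w , w≤z) = ascend ⊥ ⊥⊆ φ-⊥ u₀≤w w≤z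

  φ-order-embedding : ∀ O₁ O₂ → O₁ ⊆ O i → O₂ ⊆ O i → (O₁ ⊆ O₂) ⇔ WeakLe B (φ v O₁) (φ v O₂)
  φ-order-embedding O₁ O₂ O₁⊆O O₂⊆O =
    mk⇔ {A = O₁ ⊆ O₂} (λ O₁⊆O₂ → φ-monotone O₁ O₂ O₁⊆O₂ O₂⊆O) (φ-reflects O₁ O₂ O₁⊆O)

corollary4p4 : ∀ {n m} (F : Folding n m) → let open Folding F in
    ∀ (v : Word m) (i : Fin m) → Cover A v (i ∷ v) →
      -- φ maps subsets of O_i into the interval [f(v), f(s_i v)]
      (∀ O' → O' ⊆ Orbit orb i → InInterval B (fword v) (fword (i ∷ v)) (φ v O'))
      -- surjective onto the interval
      × (∀ w → InInterval B (fword v) (fword (i ∷ v)) w →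
           Σ (Subset n) λ O' → (O' ⊆ Orbit orb i) × (φ v O' ≈[ B ] w))
      -- injective
      × (∀ O₁ O₂ → O₁ ⊆ Orbit orb i → O₂ ⊆ Orbit orb i →
           φ v O₁ ≈[ B ] φ v O₂ → O₁ ≡ O₂)
      -- order isomorphism: inclusion ⇔ left weak order
      × (∀ O₁ O₂ → O₁ ⊆ Orbit orb i → O₂ ⊆ Orbit orb i →
           (O₁ ⊆ O₂) ⇔ WeakLe B (φ v O₁) (φ v O₂))
corollary4p4 F v i cover = φ-in-interval , φ-surjective , φ-injective , φ-order-embedding
  where open Interval F v i cover
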